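{- For all $n > 0$, $\frac{4}{5}n - \frac{8}{5} \leq \mathcal{G}(K_n, P_4) \leq \frac{4}{5}n + 1$.
   Context: $P_4$ denotes the path on 4 vertices. For a family $\mathcal{F}$ of graphs, a graph is $\mathcal{F}$-free if it contains no member of $\mathcal{F}$ as a subgraph; a subgraph $G \subseteq H$ is $\mathcal{F}$-saturated in $H$ if it is a maximal $\mathcal{F}$-free subgraph of $H$. The $\mathcal{F}$-saturation game $\mathcal{G}(H;\mathcal{F})$: two players, Prolonger and Shortener, alternately add to a graph on $V(H)$, starting from the empty graph, one edge of $H$ not yet present such that the graph remains $\mathcal{F}$-free; the game ends when the graph is $\mathcal{F}$-saturated in $H$. Prolonger aims to maximise and Shortener to minimise the number of edges added (the length of the game); $\mathcal{G}(H;\mathcal{F})$ also denotes this length under optimal play by both players (the game saturation number). The bounds hold regardless of which player moves first. $\mathcal{G}(K_n, P_4)$ means $H = K_n$, $\mathcal{F} = \{P_4\}$. -}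

module Defs where

open import Data.Nat using (ℕ; zero; suc; _*_; _<ᵇ_; _⊔_; _⊓_)
open import Data.Fin using (Fin; toℕ; _≟_)
open import Data.Bool using (Bool; true; false; _∧_; _∨_; not)
import Data.Bool
open import Data.List using (List; []; _∷_; map; filter; foldr; concatMap; allFin)
open import Data.Bool.ListAction using (any)
open import Data.Product using (_×_; _,_)
open import Relation.Nullary.Decidable using (⌊_⌋)

-- A graph on vertex set V(K_n) = Fin n, given by its list of edges.
-- Each edge is stored as an ordered pair (i , j) with toℕ i < toℕ j.
Graph : ℕ → Set
Graph n = List (Fin n × Fin n)

_==_ : ∀ {n} → Fin n → Fin n → Bool
i == j = ⌊ i ≟ j ⌋

adj : ∀ {n} → Graph n → Fin n → Fin n → Bool
adj G i j = any (λ { (a , b) → (a == i ∧ b == j) ∨ (a == j ∧ b == i) }) G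

verts : (n : ℕ) → List (Fin n)
verts n = allFin n

distinct4 : ∀ {n} → Fin n → Fin n → Fin n → Fin n → Bool
distinct4 a b c d =
  not (a == b) ∧ not (a == c) ∧ not (a == d) ∧
  not (b == c) ∧ not (b == d) ∧ not (c == d)

hasP4 : ∀ {n} → Graph n → Bool
hasP4 {n} G =
  any (λ a → any (λ b → any (λ c → any (λ d →
    distinct4 a b c d ∧ adj G a b ∧ adj G b c ∧ adj G c d)
    (verts n)) (verts n)) (verts n)) (verts n)

edgesK : (n : ℕ) → List (Fin n × Fin n)
edgesK n = concatMap (λ i → map (λ j → (i , j)) (verts n)) (verts n)

isKEdge : ∀ {n} → Fin n × Fin n → Bool
isKEdge (i , j) = toℕ i <ᵇ toℕ j

legal : ∀ {n} → Graph n → Fin n × Fin n → Bool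
legal G (i , j) = isKEdge (i , j) ∧ not (adj G i j) ∧ not (hasP4 ((i , j) ∷ G))

moves : ∀ {n} → Graph n → List (Fin n × Fin n)
moves {n} G = filter (λ e → Data.Bool._≟_ (legal G e) true) (edgesK n)

data Player : Set where
  Prolonger Shortener : Player

other : Player → Player
other Prolonger = Shortener
other Shortener = Prolonger

maxL : ℕ → List ℕ → ℕ
maxL x xs = foldr _⊔_ x xs

minL : ℕ → List ℕ → ℕ
minL x xs = foldr _⊓_ x xs

opt : Player → ℕ → List ℕ → ℕ
opt Prolonger = maxL
opt Shortener = minL

-- Minimax length of the remaining game from position G with player p to move,
-- computed with a fuel bound (each move adds an edge, so fuel ≥ number of
-- remaining edges of K_n makes this exact).
play : ∀ {n} → ℕ → Player → Graph n → ℕ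
play zero p G = 0
play (suc f) p G with moves G
... | [] = 0
... | e ∷ es = suc (opt p (play f (other p) (e ∷ G)) (map (λ e' → play f (other p) (e' ∷ G)) es))

-- The game saturation number G(K_n, P_4) when player p moves first
-- (fuel n * n exceeds the number n(n-1)/2 of edges of K_n).
gameSat : (n : ℕ) → Player → ℕ
gameSat n p = play {n} (n * n) p []

module Submission where

-- Every graph built in the P₄-saturation game on Kₙ is a disjoint union of isolated vertices,
-- K₂'s, P₃'s ("cherries"), stars with at least three leaves and triangles, because any other
-- new edge closes a P₄.  A position is therefore summarised by its census (i, a, b, s) of
-- isolated vertices, K₂'s, cherries and large stars, and every legal move is one of five census
-- moves: join two isolated vertices, hang an isolated vertex on a K₂, on a cherry centre or on a
-- star centre, or close a cherry into a triangle.  Two potentials on censuses, L = 4i + 2b and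
-- U = 4i + 2a + 5b plus bounded corrections depending on the player to move, on which counts
-- vanish and on whether i = 1, satisfy: every Shortener move lowers L by at most 5 and so does
-- some Prolonger move, every Prolonger move lowers U by at least 5 and so does some Shortener
-- move, and L ≤ 6 ≤ U when no move is left.  Hence L ≤ 5g + 6 ≤ U for the game value g, and
-- from the empty graph, with census (n, 0, 0, 0), this gives 4n ≤ 5g + 8 and 5g ≤ 4n + 5.

open import Defs

open import Data.Bool using (Bool; true; false; T; _∧_; _∨_; not)
import Data.Bool as Bool
open import Data.Bool.Properties using (T-≡; T-∧; T-not-≡; ∨-comm; ∧-comm; ∨-zeroʳ; ¬-not; ⇔→≡)
open import Data.Empty using (⊥; ⊥-elim)
open import Data.Fin using (Fin; toℕ; _≟_)
import Data.Fin as Fin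
open import Data.Fin.Properties using (toℕ-injective; suc-injective)
open import Data.List using (List; []; _∷_; map)
open import Data.List.Membership.Propositional using (_∈_; lose)
open import Data.List.Membership.Propositional.Properties
  using (∈-allFin; ∈-map⁺; ∈-map⁻; ∈-concatMap⁺; ∈-filter⁺; ∈-filter⁻; foldr-selective)
open import Data.List.Relation.Unary.Any using (here; there; satisfied)
open import Data.List.Relation.Unary.Any.Properties using (any⁺; any⁻; ¬Any[])
open import Data.Nat using (ℕ; zero; suc; _+_; _*_; _≤_; _<_; _<ᵇ_; _≤ᵇ_; z≤n; s≤s)
open import Data.Nat.Properties
  using ( +-assoc; +-identityʳ; +-cancelˡ-≡; +-cancelʳ-≤; +-monoˡ-≤; +-monoʳ-≤; +-commutativeSemigroup
        ; *-suc; *-monoˡ-≤; *-monoʳ-≤; ≤-refl; ≤-reflexive; ≤-trans; ≤-pred; <-cmp; <-irrefl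
        ; m≤m+n; m≤n+m; m<n+m; n≤1+n; <ᵇ⇒<; <⇒<ᵇ; ≤ᵇ⇒≤
        ; ⊔-sel; ⊓-sel; m≤m⊔n; m≤n⊔m; m⊓n≤m; m⊓n≤n; module ≤-Reasoning )
open import Data.Nat.Tactic.RingSolver using (solve-∀)
open import Algebra.Properties.CommutativeSemigroup +-commutativeSemigroup
  using () renaming (x∙yz≈y∙xz to +-swap)
open import Data.Product using (Σ; ∃-syntax; _×_; _,_; proj₁; proj₂)
open import Data.Sum using (_⊎_; inj₁; inj₂; [_,_]′)
open import Data.Unit using (⊤; tt)
open import Data.Vec.Functional using (updateAt)
open import Data.Vec.Functional.Properties using (updateAt-updates; updateAt-minimal)
open import Function using (Equivalence; _∘_; const; mk⇔)
open import Relation.Binary.Definitions using (tri<; tri≈; tri>)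
open import Relation.Binary.PropositionalEquality
  using (_≡_; _≢_; refl; sym; trans; cong; cong₂; subst; subst₂; module ≡-Reasoning)
open import Relation.Nullary using (¬_; Dec; yes; no; contradiction)
open import Relation.Nullary.Decidable using (toWitness)

-- Booleans and P₄-freeness

private
  T⇒≡ : ∀ {x} → T x → x ≡ true
  T⇒≡ = Equivalence.to T-≡

  ≡⇒T : ∀ {x} → x ≡ true → T x
  ≡⇒T = Equivalence.from T-≡

<ᵇ-true : ∀ {m n} → m < n → (m <ᵇ n) ≡ true
<ᵇ-true m<n = T⇒≡ (<⇒<ᵇ m<n)

<ᵇ-false : ∀ {m n} → ¬ m < n → (m <ᵇ n) ≡ false
<ᵇ-false {m} {n} m≮n = ¬-not λ e → m≮n (<ᵇ⇒< m n (≡⇒T e))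

∨-introˡ : ∀ {x} y → x ≡ true → (x ∨ y) ≡ true
∨-introˡ y refl = refl

∨-introʳ : ∀ x {y} → y ≡ true → (x ∨ y) ≡ true
∨-introʳ x refl = ∨-zeroʳ x

∨-elim : ∀ {x y} → (x ∨ y) ≡ true → x ≡ true ⊎ y ≡ true
∨-elim {true}  _ = inj₁ refl
∨-elim {false} e = inj₂ e

∧-elim : ∀ {x y} → (x ∧ y) ≡ true → x ≡ true × y ≡ true
∧-elim {true} e = refl , e

module _ {n : ℕ} where

  ==-sound : ∀ {a b : Fin n} → (a == b) ≡ true → a ≡ b
  ==-sound e = toWitness (≡⇒T e)

  ==-refl : ∀ (a : Fin n) → (a == a) ≡ true
  ==-refl a with a ≟ a
  ... | yes _  = refl
  ... | no a≢a = contradiction refl a≢a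

  ==-false : ∀ {a b : Fin n} → a ≢ b → (a == b) ≡ false
  ==-false {a} {b} a≢b with a ≟ b
  ... | yes a≡b = contradiction a≡b a≢b
  ... | no _    = refl

  ==-false⁻ : ∀ {a b : Fin n} → (a == b) ≡ false → a ≢ b
  ==-false⁻ e refl with () ← trans (sym e) (==-refl _)

  Distinct4 : Fin n → Fin n → Fin n → Fin n → Set
  Distinct4 a b c d = a ≢ b × a ≢ c × a ≢ d × b ≢ c × b ≢ d × c ≢ d

  distinct4-sound : ∀ {a b c d} → distinct4 a b c d ≡ true → Distinct4 a b c d
  distinct4-sound e =
    let (ab , e) = ∧-elim e; (ac , e) = ∧-elim e; (ad , e) = ∧-elim e
        (bc , e) = ∧-elim e; (bd , cd) = ∧-elim e
    in  ≢ ab , ≢ ac , ≢ ad , ≢ bc , ≢ bd , ≢ cd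
    where
    ≢ : ∀ {x y : Fin n} → not (x == y) ≡ true → x ≢ y
    ≢ e = ==-false⁻ (Equivalence.to T-not-≡ (≡⇒T e))

  distinct4-complete : ∀ {a b c d} → Distinct4 a b c d → distinct4 a b c d ≡ true
  distinct4-complete (ab , ac , ad , bc , bd , cd)
    rewrite ==-false ab | ==-false ac | ==-false ad | ==-false bc | ==-false bd | ==-false cd = refl

  P4Free : Graph n → Set
  P4Free G = ∀ a b c d → Distinct4 a b c d →
             adj G a b ≡ true → adj G b c ≡ true → adj G c d ≡ true → ⊥

  P4Free⇒¬hasP4 : ∀ G → P4Free G → hasP4 G ≡ false
  P4Free⇒¬hasP4 G free = ¬-not λ has →
    let (a , t) = satisfied (any⁻ _ (verts n) (≡⇒T has))
        (b , t) = satisfied (any⁻ _ (verts n) t)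
        (c , t) = satisfied (any⁻ _ (verts n) t)
        (d , t) = satisfied (any⁻ _ (verts n) t)
        (D , t) = ∧-elim (T⇒≡ t); (ab , t) = ∧-elim t; (bc , cd) = ∧-elim t
    in  free a b c d (distinct4-sound D) ab bc cd

  ¬hasP4⇒P4Free : ∀ G → hasP4 G ≡ false → P4Free G
  ¬hasP4⇒P4Free G noP4 a b c d D ab bc cd = true≢false (trans (sym (T⇒≡ has)) noP4)
    where
    true≢false : true ≢ false
    true≢false ()
    has : T (hasP4 G)
    has = any⁺ _ (lose (∈-allFin a) (any⁺ _ (lose (∈-allFin b) (any⁺ _ (lose (∈-allFin c)
            (any⁺ _ (lose (∈-allFin d) (≡⇒T path))))))))
      where
      path : (distinct4 a b c d ∧ adj G a b ∧ adj G b c ∧ adj G c d) ≡ true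
      path rewrite distinct4-complete D | ab | bc | cd = refl

-- Censuses

record Census : Set where
  constructor census
  field
    #isolated #pairs #cherries #stars : ℕ

open Census

infixr 5 _⊕_
_⊕_ : Census → Census → Census
x ⊕ y = census (#isolated x + #isolated y) (#pairs x + #pairs y) (#cherries x + #cherries y) (#stars x + #stars y)

∅ : Census
∅ = census 0 0 0 0

census-cong : ∀ {i a b s i' a' b' s'} → i ≡ i' → a ≡ a' → b ≡ b' → s ≡ s' →
              census i a b s ≡ census i' a' b' s'
census-cong refl refl refl refl = refl

⊕-assoc : ∀ x y z → (x ⊕ y) ⊕ z ≡ x ⊕ (y ⊕ z)
⊕-assoc x y z = census-cong (+-assoc (#isolated x) _ _) (+-assoc (#pairs x) _ _)
                            (+-assoc (#cherries x) _ _) (+-assoc (#stars x) _ _)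

⊕-swap : ∀ x y z → x ⊕ (y ⊕ z) ≡ y ⊕ (x ⊕ z)
⊕-swap x y z = census-cong (+-swap (#isolated x) (#isolated y) (#isolated z)) (+-swap (#pairs x) (#pairs y) (#pairs z))
                           (+-swap (#cherries x) (#cherries y) (#cherries z)) (+-swap (#stars x) (#stars y) (#stars z))

⊕-cancelˡ : ∀ x {y z} → x ⊕ y ≡ x ⊕ z → y ≡ z
⊕-cancelˡ x e =
  census-cong (+-cancelˡ-≡ (#isolated x) _ _ (cong #isolated e)) (+-cancelˡ-≡ (#pairs x) _ _ (cong #pairs e))
              (+-cancelˡ-≡ (#cherries x) _ _ (cong #cherries e)) (+-cancelˡ-≡ (#stars x) _ _ (cong #stars e))

total : ∀ {m} → (Fin m → Census) → Census
total {zero}  f = ∅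
total {suc m} f = f Fin.zero ⊕ total (f ∘ Fin.suc)

total-cong : ∀ {m} (f g : Fin m → Census) → (∀ x → f x ≡ g x) → total f ≡ total g
total-cong {zero}  f g f≗g = refl
total-cong {suc m} f g f≗g = cong₂ _⊕_ (f≗g Fin.zero) (total-cong _ _ (f≗g ∘ Fin.suc))

-- y = x - o + n, stated without truncated subtraction.
record Changed (o n x y : Census) : Set where
  constructor changed
  field equation : o ⊕ y ≡ n ⊕ x

changed-trans : ∀ {o n o' n' x y z} → Changed o n x y → Changed o' n' y z → Changed (o ⊕ o') (n ⊕ n') x z
changed-trans {o} {n} {o'} {n'} {x} {y} {z} (changed e) (changed e') = changed (begin
  (o ⊕ o') ⊕ z   ≡⟨ ⊕-assoc o o' z ⟩
  o ⊕ (o' ⊕ z)   ≡⟨ cong (o ⊕_) e' ⟩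
  o ⊕ (n' ⊕ y)   ≡⟨ ⊕-swap o n' y ⟩
  n' ⊕ (o ⊕ y)   ≡⟨ cong (n' ⊕_) e ⟩
  n' ⊕ (n ⊕ x)   ≡⟨ ⊕-swap n' n x ⟩
  n ⊕ (n' ⊕ x)   ≡⟨ ⊕-assoc n n' x ⟨
  (n ⊕ n') ⊕ x   ∎)
  where open ≡-Reasoning

changed-unique : ∀ {o n x y y'} → Changed o n x y → Changed o n x y' → y ≡ y'
changed-unique {o} (changed e) (changed e') = ⊕-cancelˡ o (trans e (sym e'))

total-changed : ∀ {m} (f g : Fin m → Census) v → (∀ x → x ≢ v → f x ≡ g x) →
                Changed (f v) (g v) (total f) (total g)
total-changed {suc m} f g Fin.zero same
  rewrite total-cong (f ∘ Fin.suc) (g ∘ Fin.suc) (λ x → same (Fin.suc x) λ ()) =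
  changed (⊕-swap (f Fin.zero) (g Fin.zero) _)
total-changed {suc m} f g (Fin.suc v) same = changed (begin
  f (Fin.suc v) ⊕ (g Fin.zero ⊕ total (g ∘ Fin.suc))  ≡⟨ ⊕-swap (f (Fin.suc v)) (g Fin.zero) _ ⟩
  g Fin.zero ⊕ (f (Fin.suc v) ⊕ total (g ∘ Fin.suc))  ≡⟨ cong₂ _⊕_ (sym (same Fin.zero λ ())) rest ⟩
  f Fin.zero ⊕ (g (Fin.suc v) ⊕ total (f ∘ Fin.suc))  ≡⟨ ⊕-swap (f Fin.zero) (g (Fin.suc v)) _ ⟩
  g (Fin.suc v) ⊕ (f Fin.zero ⊕ total (f ∘ Fin.suc))  ∎)
  where
  open ≡-Reasoning
  rest : f (Fin.suc v) ⊕ total (g ∘ Fin.suc) ≡ g (Fin.suc v) ⊕ total (f ∘ Fin.suc)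
  rest = Changed.equation
           (total-changed (f ∘ Fin.suc) (g ∘ Fin.suc) v (λ x x≢v → same (Fin.suc x) (x≢v ∘ suc-injective)))

module _ (π : Census → ℕ) (π-⊕ : ∀ x y → π (x ⊕ y) ≡ π x + π y) (π-∅ : π ∅ ≡ 0) where

  total-witness : ∀ {m} (f : Fin m → Census) → 1 ≤ π (total f) → ∃[ x ] 1 ≤ π (f x)
  total-witness {zero} f h with () ← subst (1 ≤_) π-∅ h
  total-witness {suc m} f h with π (f Fin.zero) in e | subst (1 ≤_) (π-⊕ (f Fin.zero) (total (f ∘ Fin.suc))) h
  ... | suc _ | _  = Fin.zero , subst (1 ≤_) (sym e) (s≤s z≤n)
  ... | zero  | h' = let (x , hx) = total-witness (f ∘ Fin.suc) h' in Fin.suc x , hx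

  total-≥ : ∀ {m} (f : Fin m → Census) v → π (f v) ≤ π (total f)
  total-≥ f Fin.zero    = subst (π (f Fin.zero) ≤_) (sym (π-⊕ _ _)) (m≤m+n _ _)
  total-≥ f (Fin.suc v) =
    subst (π (f (Fin.suc v)) ≤_) (sym (π-⊕ _ _)) (≤-trans (total-≥ (f ∘ Fin.suc) v) (m≤n+m _ _))

  total-two : ∀ {m} (f : Fin m → Census) → 2 ≤ π (total f) →
              (∃[ x ] 2 ≤ π (f x)) ⊎ (∃[ x ] ∃[ y ] x ≢ y × 1 ≤ π (f x) × 1 ≤ π (f y))
  total-two {zero} f h with () ← subst (2 ≤_) π-∅ h
  total-two {suc m} f h with π (f Fin.zero) in e | subst (2 ≤_) (π-⊕ (f Fin.zero) (total (f ∘ Fin.suc))) h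
  ... | suc (suc _) | _ = inj₁ (Fin.zero , subst (2 ≤_) (sym e) (s≤s (s≤s z≤n)))
  ... | suc zero | s≤s h' =
    let (y , hy) = total-witness (f ∘ Fin.suc) h'
    in  inj₂ (Fin.zero , Fin.suc y , (λ ()) , subst (1 ≤_) (sym e) (s≤s z≤n) , hy)
  ... | zero | h' with total-two (f ∘ Fin.suc) h'
  ...   | inj₁ (x , hx)                = inj₁ (Fin.suc x , hx)
  ...   | inj₂ (x , y , x≢y , hx , hy) = inj₂ (Fin.suc x , Fin.suc y , x≢y ∘ suc-injective , hx , hy)

-- The census game

infix 4 _⟶_
data _⟶_ : Census → Census → Set where
  join   : ∀ {i a b s} → census (2 + i) a b s ⟶ census i (1 + a) b s
  extend : ∀ {i a b s} → census (1 + i) (1 + a) b s ⟶ census i a (1 + b) s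
  grow   : ∀ {i a b s} → census (1 + i) a (1 + b) s ⟶ census i a b (1 + s)
  attach : ∀ {i a b s} → census (1 + i) a b (1 + s) ⟶ census i a b (1 + s)
  close  : ∀ {i a b s} → census i a (1 + b) s ⟶ census i a b s

lost gained : ∀ {c c'} → c ⟶ c' → Census
lost join     = census 2 0 0 0
lost extend   = census 1 1 0 0
lost grow     = census 1 0 1 0
lost attach   = census 1 0 0 0
lost close    = census 0 0 1 0
gained join   = census 0 1 0 0
gained extend = census 0 0 1 0
gained grow   = census 0 0 0 1
gained attach = ∅
gained close  = ∅

⟶-changed : ∀ {c c'} (mv : c ⟶ c') → Changed (lost mv) (gained mv) c c'
⟶-changed join   = changed refl
⟶-changed extend = changed refl
⟶-changed grow   = changed refl
⟶-changed attach = changed refl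
⟶-changed close  = changed refl

join-step : ∀ {c c'} → Changed (census 2 0 0 0) (census 0 1 0 0) c c' → c ⟶ c'
join-step {census _ _ _ _} {census _ _ _ _} (changed refl) = join

extend-step : ∀ {c c'} → Changed (census 1 1 0 0) (census 0 0 1 0) c c' → c ⟶ c'
extend-step {census _ _ _ _} {census _ _ _ _} (changed refl) = extend

grow-step : ∀ {c c'} → Changed (census 1 0 1 0) (census 0 0 0 1) c c' → c ⟶ c'
grow-step {census _ _ _ _} {census _ _ _ _} (changed refl) = grow

attach-step : ∀ {c c'} → Changed (census 1 0 0 0) ∅ c c' → 1 ≤ #stars c → c ⟶ c'
attach-step {census _ _ _ (suc _)} {census _ _ _ _} (changed refl) _ = attach

close-step : ∀ {c c'} → Changed (census 0 0 1 0) ∅ c c' → c ⟶ c'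
close-step {census _ _ _ _} {census _ _ _ _} (changed refl) = close

Playable : Census → Set
Playable c = ∃[ c' ] c ⟶ c'

measure : Census → ℕ
measure (census i a b s) = 2 * i + b

upperLinear : Census → ℕ
upperLinear (census i a b s) = 4 * i + 2 * a + 5 * b

measureDrop upperDrop : ∀ {c c'} → c ⟶ c' → ℕ
measureDrop join   = 4
measureDrop extend = 1
measureDrop grow   = 3
measureDrop attach = 2
measureDrop close  = 1
upperDrop join   = 6
upperDrop extend = 1
upperDrop grow   = 9
upperDrop attach = 4
upperDrop close  = 5

measure-drop : ∀ {c c'} (mv : c ⟶ c') → measure c ≡ measureDrop mv + measure c'
measure-drop (join {i} {b = b})   = lemma i b
  where lemma : ∀ i b → 2 * (2 + i) + b ≡ 4 + (2 * i + b)
        lemma = solve-∀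
measure-drop (extend {i} {b = b}) = lemma i b
  where lemma : ∀ i b → 2 * (1 + i) + b ≡ 1 + (2 * i + (1 + b))
        lemma = solve-∀
measure-drop (grow {i} {b = b})   = lemma i b
  where lemma : ∀ i b → 2 * (1 + i) + (1 + b) ≡ 3 + (2 * i + b)
        lemma = solve-∀
measure-drop (attach {i} {b = b}) = lemma i b
  where lemma : ∀ i b → 2 * (1 + i) + b ≡ 2 + (2 * i + b)
        lemma = solve-∀
measure-drop (close {i} {b = b})  = lemma i b
  where lemma : ∀ i b → 2 * i + (1 + b) ≡ 1 + (2 * i + b)
        lemma = solve-∀

measure-decreases : ∀ {c c'} → c ⟶ c' → measure c' < measure c
measure-decreases {c' = c'} mv = subst (measure c' <_) (sym (measure-drop mv)) (m<n+m (measure c') (positive mv))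
  where
  positive : ∀ {c c'} (mv : c ⟶ c') → 0 < measureDrop mv
  positive join   = s≤s z≤n
  positive extend = s≤s z≤n
  positive grow   = s≤s z≤n
  positive attach = s≤s z≤n
  positive close  = s≤s z≤n

upperLinear-drop : ∀ {c c'} (mv : c ⟶ c') → upperLinear c ≡ upperDrop mv + upperLinear c'
upperLinear-drop (join {i} {a} {b})   = lemma i a b
  where lemma : ∀ i a b → 4 * (2 + i) + 2 * a + 5 * b ≡ 6 + (4 * i + 2 * (1 + a) + 5 * b)
        lemma = solve-∀
upperLinear-drop (extend {i} {a} {b}) = lemma i a b
  where lemma : ∀ i a b → 4 * (1 + i) + 2 * (1 + a) + 5 * b ≡ 1 + (4 * i + 2 * a + 5 * (1 + b))
        lemma = solve-∀
upperLinear-drop (grow {i} {a} {b})   = lemma i a b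
  where lemma : ∀ i a b → 4 * (1 + i) + 2 * a + 5 * (1 + b) ≡ 9 + (4 * i + 2 * a + 5 * b)
        lemma = solve-∀
upperLinear-drop (attach {i} {a} {b}) = lemma i a b
  where lemma : ∀ i a b → 4 * (1 + i) + 2 * a + 5 * b ≡ 4 + (4 * i + 2 * a + 5 * b)
        lemma = solve-∀
upperLinear-drop (close {i} {a} {b})  = lemma i a b
  where lemma : ∀ i a b → 4 * i + 2 * a + 5 * (1 + b) ≡ 5 + (4 * i + 2 * a + 5 * b)
        lemma = solve-∀

isZero : ℕ → Bool
isZero zero    = true
isZero (suc _) = false

data Size : Set where
  none one many : Size

bump : Size → Size
bump none = one
bump one  = many
bump many = many

size : ℕ → Size
size zero    = none
size (suc n) = bump (size n)

-- The potentials depend on a census only through the flags below, so every step inequality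
-- between their constant parts is a finite check, decided by evaluation.
every : (Bool → Bool) → Bool
every f = f true ∧ f false

T-∧-elim : ∀ x {y} → T (x ∧ y) → T x × T y
T-∧-elim x = Equivalence.to (T-∧ {x})

every-sound : ∀ f → T (every f) → ∀ x → T (f x)
every-sound f t true  = proj₁ (T-∧-elim (f true) t)
every-sound f t false = proj₂ (T-∧-elim (f true) t)

everySize : (Size → Bool) → Bool
everySize f = f none ∧ (f one ∧ f many)

everySize-sound : ∀ f → T (everySize f) → ∀ x → T (f x)
everySize-sound f t none = proj₁ (T-∧-elim (f none) t)
everySize-sound f t one  = proj₁ (T-∧-elim (f one) (proj₂ (T-∧-elim (f none) t)))
everySize-sound f t many = proj₂ (T-∧-elim (f one) (proj₂ (T-∧-elim (f none) t)))

by-flags : (f : Bool → Bool → Bool → Bool) → T (every λ x → every λ y → every λ z → f x y z) →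
           ∀ x y z → T (f x y z)
by-flags f t x y z =
  every-sound (f x y) (every-sound (λ y → every (f x y)) (every-sound (λ x → every λ y → every (f x y)) t x) y) z

by-size-flags : (f : Size → Bool → Bool → Bool → Bool) →
                T (everySize λ w → every λ x → every λ y → every λ z → f w x y z) →
                ∀ w x y z → T (f w x y z)
by-size-flags f t w = by-flags (f w) (everySize-sound (λ w → every λ x → every λ y → every (f w x y)) t w)

checked : ∀ {m n} → T (m ≤ᵇ n) → m ≤ n
checked = ≤ᵇ⇒≤ _ _

checked-flags : ∀ a b s (f : Bool → Bool → Bool → Bool) →
                T (every λ x → every λ y → every λ z → f x y z) → T (f (isZero a) (isZero b) (isZero s))
checked-flags a b s f t = by-flags f t (isZero a) (isZero b) (isZero s)

checked-size-flags : ∀ i a b s (f : Size → Bool → Bool → Bool → Bool) →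
                     T (everySize λ w → every λ x → every λ y → every λ z → f w x y z) →
                     T (f (size i) (isZero a) (isZero b) (isZero s))
checked-size-flags i a b s f t = by-size-flags f t (size i) (isZero a) (isZero b) (isZero s)

-- Constant parts of the potentials, found by solving the step inequalities below by computer;
-- the flags say whether the numbers of K₂'s, cherries and stars vanish.
lowerTable : Player → Bool → Bool → Bool → ℕ
lowerTable Shortener true  true  true  = 2
lowerTable Shortener _     _     _     = 3
lowerTable Prolonger false _     _     = 6
lowerTable Prolonger true  false _     = 5
lowerTable Prolonger true  true  false = 4
lowerTable Prolonger true  true  true  = 0

upperTable : Player → Size → Bool → Bool → Bool → ℕ
upperTable _         none true  _     _     = 6
upperTable _         none false _     _     = 4
upperTable Prolonger one  false _     _     = 10
upperTable Prolonger one  true  _     false = 7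
upperTable Prolonger one  true  _     true  = 2
upperTable Prolonger many _     _     _     = 10
upperTable Shortener one  true  false _     = 2
upperTable Shortener one  true  true  false = 7
upperTable Shortener one  true  true  true  = 2
upperTable Shortener one  false false _     = 0
upperTable Shortener one  false true  false = 5
upperTable Shortener one  false true  true  = 10
upperTable Shortener many _     true  _     = 9
upperTable Shortener many _     false _     = 6

lowerBase upperBase : Player → Census → ℕ
lowerBase p (census i a b s) = lowerTable p (isZero a) (isZero b) (isZero s)
upperBase p (census i a b s) = upperTable p (size i) (isZero a) (isZero b) (isZero s)

lowerPotential upperPotential : Player → Census → ℕ
lowerPotential p c = lowerBase p c + 2 * measure c
upperPotential p c = upperBase p c + upperLinear c

lower-shift : ∀ {κ κ' d M M'} → M ≡ d + M' → κ + 2 * d ≤ 5 + κ' → κ + 2 * M ≤ 5 + (κ' + 2 * M')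
lower-shift {κ} {κ'} {d} {M' = M'} refl le = begin
  κ + 2 * (d + M')     ≡⟨ lemma κ d M' ⟩
  κ + 2 * d + 2 * M'   ≤⟨ +-monoˡ-≤ (2 * M') le ⟩
  5 + κ' + 2 * M'      ≡⟨ +-assoc 5 κ' (2 * M') ⟩
  5 + (κ' + 2 * M')    ∎
  where
  open ≤-Reasoning
  lemma : ∀ κ d M' → κ + 2 * (d + M') ≡ κ + 2 * d + 2 * M'
  lemma = solve-∀

upper-shift : ∀ {κ κ' d U U'} → U ≡ d + U' → 5 + κ' ≤ κ + d → 5 + (κ' + U') ≤ κ + U
upper-shift {κ} {κ'} {d} {U' = U'} refl le = begin
  5 + (κ' + U')   ≡⟨ +-assoc 5 κ' U' ⟨
  5 + κ' + U'     ≤⟨ +-monoˡ-≤ U' le ⟩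
  κ + d + U'      ≡⟨ +-assoc κ d U' ⟩
  κ + (d + U')    ∎
  where open ≤-Reasoning

lower-step : ∀ p q {c c'} (mv : c ⟶ c') →
  T (lowerBase p c + 2 * measureDrop mv ≤ᵇ 5 + lowerBase q c') → lowerPotential p c ≤ 5 + lowerPotential q c'
lower-step p q {c} {c'} mv t =
  lower-shift {lowerBase p c} {lowerBase q c'} {measureDrop mv} {M' = measure c'} (measure-drop mv) (checked t)

upper-step : ∀ p q {c c'} (mv : c ⟶ c') →
  T (5 + upperBase q c' ≤ᵇ upperBase p c + upperDrop mv) → 5 + upperPotential q c' ≤ upperPotential p c
upper-step p q {c} {c'} mv t =
  upper-shift {upperBase p c} {upperBase q c'} {upperDrop mv} {U' = upperLinear c'} (upperLinear-drop mv) (checked t)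

lower-Shortener-move : ∀ {c c'} → c ⟶ c' → lowerPotential Shortener c ≤ 5 + lowerPotential Prolonger c'
lower-Shortener-move mv = lower-step Shortener Prolonger mv (base mv)
  where
  base : ∀ {c c'} (mv : c ⟶ c') → T (lowerBase Shortener c + 2 * measureDrop mv ≤ᵇ 5 + lowerBase Prolonger c')
  base (join {a = a} {b} {s}) = checked-flags a b s
    (λ za zb zs → lowerTable Shortener za zb zs + 8 ≤ᵇ 5 + lowerTable Prolonger false zb zs) _
  base (extend {a = a} {b} {s}) = checked-flags a b s
    (λ za zb zs → lowerTable Shortener false zb zs + 2 ≤ᵇ 5 + lowerTable Prolonger za false zs) _
  base (grow {a = a} {b} {s}) = checked-flags a b s
    (λ za zb zs → lowerTable Shortener za false zs + 6 ≤ᵇ 5 + lowerTable Prolonger za zb false) _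
  base (attach {a = a} {b} {s}) = checked-flags a b s
    (λ za zb _ → lowerTable Shortener za zb false + 4 ≤ᵇ 5 + lowerTable Prolonger za zb false) _
  base (close {a = a} {b} {s}) = checked-flags a b s
    (λ za zb zs → lowerTable Shortener za false zs + 2 ≤ᵇ 5 + lowerTable Prolonger za zb zs) _

upper-Prolonger-move : ∀ {c c'} → c ⟶ c' → 5 + upperPotential Shortener c' ≤ upperPotential Prolonger c
upper-Prolonger-move mv = upper-step Prolonger Shortener mv (base mv)
  where
  base : ∀ {c c'} (mv : c ⟶ c') → T (5 + upperBase Shortener c' ≤ᵇ upperBase Prolonger c + upperDrop mv)
  base (join {i} {a} {b} {s}) = checked-size-flags i a b s
    (λ w za zb zs → 5 + upperTable Shortener w false zb zs ≤ᵇ upperTable Prolonger (bump (bump w)) za zb zs + 6) _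
  base (extend {i} {a} {b} {s}) = checked-size-flags i a b s
    (λ w za zb zs → 5 + upperTable Shortener w za false zs ≤ᵇ upperTable Prolonger (bump w) false zb zs + 1) _
  base (grow {i} {a} {b} {s}) = checked-size-flags i a b s
    (λ w za zb zs → 5 + upperTable Shortener w za zb false ≤ᵇ upperTable Prolonger (bump w) za false zs + 9) _
  base (attach {i} {a} {b} {s}) = checked-size-flags i a b s
    (λ w za zb _ → 5 + upperTable Shortener w za zb false ≤ᵇ upperTable Prolonger (bump w) za zb false + 4) _
  base (close {i} {a} {b} {s}) = checked-size-flags i a b s
    (λ w za zb zs → 5 + upperTable Shortener w za zb zs ≤ᵇ upperTable Prolonger w za false zs + 5) _

lower-choice : ∀ {c c'} (mv : c ⟶ c') →
  T (lowerBase Prolonger c + 2 * measureDrop mv ≤ᵇ 5 + lowerBase Shortener c') →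
  ∃[ c'' ] c ⟶ c'' × lowerPotential Prolonger c ≤ 5 + lowerPotential Shortener c''
lower-choice mv t = _ , mv , lower-step Prolonger Shortener mv t

upper-choice : ∀ {c c'} (mv : c ⟶ c') →
  T (5 + upperBase Prolonger c' ≤ᵇ upperBase Shortener c + upperDrop mv) →
  ∃[ c'' ] c ⟶ c'' × 5 + upperPotential Prolonger c'' ≤ upperPotential Shortener c
upper-choice mv t = _ , mv , upper-step Shortener Prolonger mv t

lower-Prolonger-strategy : ∀ c → Playable c →
  ∃[ c' ] c ⟶ c' × lowerPotential Prolonger c ≤ 5 + lowerPotential Shortener c'
lower-Prolonger-strategy (census i a (suc b) s) _ = lower-choice close (checked-flags a b s
  (λ za zb zs → lowerTable Prolonger za false zs + 2 ≤ᵇ 5 + lowerTable Shortener za zb zs) _)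
lower-Prolonger-strategy (census (suc i) (suc a) zero s) _ = lower-choice extend (checked-flags a 0 s
  (λ za _ zs → lowerTable Prolonger false true zs + 2 ≤ᵇ 5 + lowerTable Shortener za false zs) _)
lower-Prolonger-strategy (census (suc i) zero zero (suc s)) _ = lower-choice attach _
lower-Prolonger-strategy (census (suc (suc i)) zero zero zero) _ = lower-choice join _
lower-Prolonger-strategy (census zero a zero s) (_ , ())
lower-Prolonger-strategy (census (suc zero) zero zero zero) (_ , ())

upper-Shortener-strategy : ∀ c → Playable c →
  ∃[ c' ] c ⟶ c' × 5 + upperPotential Prolonger c' ≤ upperPotential Shortener c
upper-Shortener-strategy (census (suc i) a (suc b) s) _ = upper-choice grow (checked-size-flags i a b s
  (λ w za zb zs → 5 + upperTable Prolonger w za zb false ≤ᵇ upperTable Shortener (bump w) za false zs + 9) _)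
upper-Shortener-strategy (census (suc (suc i)) a zero s) _ = upper-choice join (checked-size-flags i a 0 s
  (λ w za _ zs → 5 + upperTable Prolonger w false true zs ≤ᵇ upperTable Shortener (bump (bump w)) za true zs + 6) _)
upper-Shortener-strategy (census (suc zero) a zero (suc s)) _ = upper-choice attach (checked-flags a 0 (suc s)
  (λ za _ _ → 5 + upperTable Prolonger none za true false ≤ᵇ upperTable Shortener one za true false + 4) _)
upper-Shortener-strategy (census (suc zero) (suc a) zero zero) _ = upper-choice extend (checked-flags a 0 0
  (λ za _ _ → 5 + upperTable Prolonger none za false true ≤ᵇ upperTable Shortener one false true true + 1) _)
upper-Shortener-strategy (census zero a (suc b) s) _ = upper-choice close (checked-flags a b s
  (λ za zb zs → 5 + upperTable Prolonger none za zb zs ≤ᵇ upperTable Shortener none za false zs + 5) _)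
upper-Shortener-strategy (census zero a zero s) (_ , ())
upper-Shortener-strategy (census (suc zero) zero zero zero) (_ , ())

pairs-bound : ∀ a → 6 ≤ 4 + upperLinear (census 0 (1 + a) 0 0)
pairs-bound a = subst (6 ≤_) (lemma a) (m≤m+n 6 (2 * a))
  where lemma : ∀ a → 6 + 2 * a ≡ 4 + (4 * 0 + 2 * (1 + a) + 5 * 0)
        lemma = solve-∀

data Stuck : Census → Set where
  no-isolated  : ∀ {a s} → Stuck (census 0 a 0 s)
  one-isolated : Stuck (census 1 0 0 0)

¬Playable⇒Stuck : ∀ c → ¬ Playable c → Stuck c
¬Playable⇒Stuck (census i a (suc b) s) ¬p = ⊥-elim (¬p (_ , close))
¬Playable⇒Stuck (census (suc (suc i)) a zero s) ¬p = ⊥-elim (¬p (_ , join))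
¬Playable⇒Stuck (census (suc zero) (suc a) zero s) ¬p = ⊥-elim (¬p (_ , extend))
¬Playable⇒Stuck (census (suc zero) zero zero (suc s)) ¬p = ⊥-elim (¬p (_ , attach))
¬Playable⇒Stuck (census (suc zero) zero zero zero) _ = one-isolated
¬Playable⇒Stuck (census zero a zero s) _ = no-isolated

measure≤0⇒Stuck : ∀ c → measure c ≤ 0 → Stuck c
measure≤0⇒Stuck (census zero a zero s) _ = no-isolated

lower-stuck : ∀ p {c} → Stuck c → lowerPotential p c ≤ 6
lower-stuck Shortener (no-isolated {a} {s}) =
  checked (checked-flags a 0 s (λ za _ zs → lowerTable Shortener za true zs + 0 ≤ᵇ 6) _)
lower-stuck Prolonger (no-isolated {a} {s}) =
  checked (checked-flags a 0 s (λ za _ zs → lowerTable Prolonger za true zs + 0 ≤ᵇ 6) _)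
lower-stuck Shortener one-isolated = checked _
lower-stuck Prolonger one-isolated = checked _

upper-stuck : ∀ p {c} → Stuck c → 6 ≤ upperPotential p c
upper-stuck Shortener (no-isolated {zero})  = checked _
upper-stuck Prolonger (no-isolated {zero})  = checked _
upper-stuck Shortener (no-isolated {suc a}) = pairs-bound a
upper-stuck Prolonger (no-isolated {suc a}) = pairs-bound a
upper-stuck Shortener one-isolated = checked _
upper-stuck Prolonger one-isolated = checked _

-- Roles

-- A vertex's role records its component in a P₄-free graph built by the game: an isolated
-- vertex, an endpoint of a K₂ (with its partner), the centre of a P₃ (with its two leaves),
-- the centre of a star with at least three leaves (three of them named), a leaf (with its
-- centre), or a vertex of a triangle (with the other two).  Adjacency is read off from the
-- vertices a role names; a star centre names none, its leaves name it instead.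
data Role (n : ℕ) : Set where
  isolated : Role n
  paired   : Fin n → Role n
  cherry   : Fin n → Fin n → Role n
  star     : Fin n → Fin n → Fin n → Role n
  leaf     : Fin n → Role n
  triangle : Fin n → Fin n → Role n

Roles : ℕ → Set
Roles n = Fin n → Role n

module _ {n : ℕ} where

  names : Role n → Fin n → Bool
  names isolated       v = false
  names (paired p)     v = p == v
  names (cherry x y)   v = x == v ∨ y == v
  names (star _ _ _)   v = false
  names (leaf c)       v = c == v
  names (triangle p q) v = p == v ∨ q == v

  roleAdj : Roles n → Fin n → Fin n → Bool
  roleAdj r u v = names (r u) v ∨ names (r v) u

  roleAdj-sym : ∀ r u v → roleAdj r u v ≡ roleAdj r v u
  roleAdj-sym r u v = ∨-comm (names (r u) v) (names (r v) u)

  isolated? : (ρ : Role n) → Dec (ρ ≡ isolated)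
  isolated? isolated       = yes refl
  isolated? (paired _)     = no λ ()
  isolated? (cherry _ _)   = no λ ()
  isolated? (star _ _ _)   = no λ ()
  isolated? (leaf _)       = no λ ()
  isolated? (triangle _ _) = no λ ()

  IsCentre : Role n → Set
  IsCentre (cherry _ _) = ⊤
  IsCentre (star _ _ _) = ⊤
  IsCentre _            = ⊥

  record WellFormed (r : Roles n) : Set where
    field
      paired-partner : ∀ {u p} → r u ≡ paired p → u ≢ p × r p ≡ paired u
      cherry-leaves  : ∀ {u x y} → r u ≡ cherry x y →
                       x ≢ y × r x ≡ leaf u × r y ≡ leaf u × (∀ v → r v ≡ leaf u → v ≡ x ⊎ v ≡ y)
      star-leaves    : ∀ {u x y z} → r u ≡ star x y z →
                       x ≢ y × x ≢ z × y ≢ z × r x ≡ leaf u × r y ≡ leaf u × r z ≡ leaf u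
      leaf-centre    : ∀ {u c} → r u ≡ leaf c → IsCentre (r c)
      triangle-next  : ∀ {u p q} → r u ≡ triangle p q → u ≢ p × p ≢ q × q ≢ u × r p ≡ triangle q u

  NeighbourOf : Role n → Roles n → Fin n → Fin n → Set
  NeighbourOf isolated       r u v = ⊥
  NeighbourOf (paired p)     r u v = v ≡ p
  NeighbourOf (cherry x y)   r u v = v ≡ x ⊎ v ≡ y
  NeighbourOf (star _ _ _)   r u v = r v ≡ leaf u
  NeighbourOf (leaf c)       r u v = v ≡ c
  NeighbourOf (triangle p q) r u v = v ≡ p ⊎ v ≡ q

  ==-either : ∀ (x y v : Fin n) → (x == v ∨ y == v) ≡ true → v ≡ x ⊎ v ≡ y
  ==-either x y v e with ∨-elim e
  ... | inj₁ x=v = inj₁ (sym (==-sound x=v))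
  ... | inj₂ y=v = inj₂ (sym (==-sound y=v))

  names⇒neighbour : ∀ (r : Roles n) u v → names (r u) v ≡ true → NeighbourOf (r u) r u v
  names⇒neighbour r u v e with r u
  ... | paired p     = sym (==-sound e)
  ... | cherry x y   = ==-either x y v e
  ... | leaf c       = sym (==-sound e)
  ... | triangle p q = ==-either p q v e

  paired-injective : ∀ {a b : Fin n} → paired a ≡ paired b → a ≡ b
  paired-injective refl = refl

  leaf-injective : ∀ {a b : Fin n} → leaf a ≡ leaf b → a ≡ b
  leaf-injective refl = refl

  ≢-by-role : ∀ {r : Roles n} {a b ρ σ} → r a ≡ ρ → r b ≡ σ → ρ ≢ σ → a ≢ b
  ≢-by-role ra rb ρ≢σ refl = ρ≢σ (trans (sym ra) rb)

  centre-role : ∀ {r : Roles n} → WellFormed r → ∀ {u c} → r u ≡ leaf c →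
                (∃[ x ] ∃[ y ] r c ≡ cherry x y) ⊎ (∃[ x ] ∃[ y ] ∃[ z ] r c ≡ star x y z)
  centre-role {r} wf {c = c} ru with r c | WellFormed.leaf-centre wf ru
  ... | cherry x y | _ = inj₁ (x , y , refl)
  ... | star x y z | _ = inj₂ (x , y , z , refl)

  module WellFormedRoles {r : Roles n} (wf : WellFormed r) where
    open WellFormed wf

    roleAdj⇒neighbour : ∀ u v → roleAdj r u v ≡ true → NeighbourOf (r u) r u v
    roleAdj⇒neighbour u v e with ∨-elim e
    ... | inj₁ u→v = names⇒neighbour r u v u→v
    ... | inj₂ v→u with r v in rv
    ... | paired q rewrite sym (==-sound v→u) | proj₂ (paired-partner rv) = refl
    ... | cherry x y with ==-either x y u v→u
    ...   | inj₁ refl rewrite proj₁ (proj₂ (cherry-leaves rv))          = refl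
    ...   | inj₂ refl rewrite proj₁ (proj₂ (proj₂ (cherry-leaves rv))) = refl
    roleAdj⇒neighbour u v e | inj₂ v→u | leaf c with ==-sound v→u
    ... | refl with r u in ru | leaf-centre rv
    ... | cherry _ _  | _ = proj₂ (proj₂ (proj₂ (cherry-leaves ru))) v rv
    ... | star _ _ _  | _ = rv
    roleAdj⇒neighbour u v e | inj₂ v→u | triangle p q with ==-either p q u v→u
    ... | inj₁ refl rewrite proj₂ (proj₂ (proj₂ (triangle-next rv))) = inj₂ refl
    ... | inj₂ refl
      rewrite proj₂ (proj₂ (proj₂ (triangle-next (proj₂ (proj₂ (proj₂ (triangle-next rv))))))) = inj₁ refl

    -- The middle vertex b has two neighbours, so it is a centre or a triangle vertex; then all
    -- neighbours of c lie in {a, b}, leaving no room for d.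
    roleAdj-P4Free : ∀ a b c d → Distinct4 a b c d →
                     roleAdj r a b ≡ true → roleAdj r b c ≡ true → roleAdj r c d ≡ true → ⊥
    roleAdj-P4Free a b c d (a≢b , a≢c , a≢d , b≢c , b≢d , c≢d) ab bc cd = go
      where
      c~d : NeighbourOf (r c) r c d
      c~d = roleAdj⇒neighbour c d cd
      go : ⊥
      go with r b in rb | roleAdj⇒neighbour b a (trans (roleAdj-sym r b a) ab) | roleAdj⇒neighbour b c bc
      ... | paired p     | refl      | refl      = a≢c refl
      ... | leaf p       | refl      | refl      = a≢c refl
      ... | star x y z   | _         | rc        = b≢d (sym (subst (λ ρ → NeighbourOf ρ r c d) rc c~d))
      ... | cherry x y   | _         | c∈        = b≢d (sym (subst (λ ρ → NeighbourOf ρ r c d) (rc c∈) c~d))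
        where
        rc : c ≡ x ⊎ c ≡ y → r c ≡ leaf b
        rc (inj₁ refl) = proj₁ (proj₂ (cherry-leaves rb))
        rc (inj₂ refl) = proj₁ (proj₂ (proj₂ (cherry-leaves rb)))
      ... | triangle p q | inj₁ refl | inj₁ refl = a≢c refl
      ... | triangle p q | inj₂ refl | inj₂ refl = a≢c refl
      ... | triangle p q | inj₂ refl | inj₁ refl
        with subst (λ ρ → NeighbourOf ρ r c d) (proj₂ (proj₂ (proj₂ (triangle-next rb)))) c~d
      ...   | inj₁ refl = a≢d refl
      ...   | inj₂ refl = b≢d refl
      go | triangle p q | inj₁ refl | inj₂ refl
        with subst (λ ρ → NeighbourOf ρ r c d)
                   (proj₂ (proj₂ (proj₂ (triangle-next (proj₂ (proj₂ (proj₂ (triangle-next rb)))))))) c~d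
      ...   | inj₁ refl = b≢d refl
      ...   | inj₂ refl = a≢d refl

    roleAdj-irreflexive : ∀ x → roleAdj r x x ≡ false
    roleAdj-irreflexive x = ¬-not λ e → no-loop (roleAdj⇒neighbour x x e)
      where
      no-loop : NeighbourOf (r x) r x x → ⊥
      no-loop x~x with r x in rx
      no-loop ()          | isolated
      no-loop x~x         | paired p     = proj₁ (paired-partner rx) x~x
      no-loop (inj₁ refl) | cherry a b   with () ← trans (sym rx) (proj₁ (proj₂ (cherry-leaves rx)))
      no-loop (inj₂ refl) | cherry a b   with () ← trans (sym rx) (proj₁ (proj₂ (proj₂ (cherry-leaves rx))))
      no-loop x~x         | star a b c   with () ← trans (sym rx) x~x
      no-loop refl        | leaf c       = subst IsCentre rx (leaf-centre rx)
      no-loop (inj₁ refl) | triangle p q = proj₁ (triangle-next rx) refl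
      no-loop (inj₂ refl) | triangle p q = proj₁ (proj₂ (proj₂ (triangle-next rx))) refl

    names⇒roleAdj : ∀ {x y ρ} → r x ≡ ρ → names ρ y ≡ true → roleAdj r x y ≡ true
    names⇒roleAdj {x} {y} rx x→y = ∨-introˡ (names (r y) x) (subst (λ ρ → names ρ y ≡ true) (sym rx) x→y)

    named⇒roleAdj : ∀ {x y ρ} → r y ≡ ρ → names ρ x ≡ true → roleAdj r x y ≡ true
    named⇒roleAdj {x} {y} ry y→x = ∨-introʳ (names (r x) y) (subst (λ ρ → names ρ x ≡ true) (sym ry) y→x)

    some-neighbour : ∀ y → r y ≢ isolated → ∃[ d ] roleAdj r y d ≡ true
    some-neighbour y y≢ = by-role (r y) refl
      where
      by-role : ∀ ρ → r y ≡ ρ → ∃[ d ] roleAdj r y d ≡ true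
      by-role isolated       ry = contradiction ry y≢
      by-role (paired p)     ry = p , names⇒roleAdj ry (==-refl p)
      by-role (cherry a b)   ry = a , names⇒roleAdj ry (∨-introˡ _ (==-refl a))
      by-role (star a b c)   ry = a , named⇒roleAdj (proj₁ (proj₂ (proj₂ (proj₂ (star-leaves ry))))) (==-refl y)
      by-role (leaf c)       ry = c , names⇒roleAdj ry (==-refl c)
      by-role (triangle p q) ry = p , names⇒roleAdj ry (∨-introˡ _ (==-refl p))

    other-leaf : ∀ {y c} → r y ≡ leaf c → ∃[ z ] r z ≡ leaf c × y ≢ z
    other-leaf {y} ry with centre-role wf ry
    ... | inj₁ (a , b , rc) with cherry-leaves rc
    ...   | (a≢b , ra , rb , only) with only y ry
    ...     | inj₁ refl = b , rb , a≢b
    ...     | inj₂ refl = a , ra , a≢b ∘ sym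
    other-leaf {y} ry | inj₂ (a , b , d , rc) with star-leaves rc
    ...   | (a≢b , _ , _ , ra , rb , _) with y ≟ a
    ...     | yes refl = b , rb , a≢b
    ...     | no y≢a   = a , ra , y≢a

    centre≢ : ∀ {c a ρ} → IsCentre (r c) → r a ≡ ρ → ¬ IsCentre ρ → c ≢ a
    centre≢ centre ra ¬centre refl rewrite ra = ¬centre centre

    data NeighbourShape (s : Fin n) : Set where
      two-neighbours : ∀ a₁ a₂ → a₁ ≢ a₂ → roleAdj r s a₁ ≡ true → roleAdj r s a₂ ≡ true →
                       NeighbourShape s
      paired-end     : ∀ z → r s ≡ paired z → NeighbourShape s
      leaf-end       : ∀ z → r s ≡ leaf z → NeighbourShape s

    neighbour-shape : ∀ s → r s ≢ isolated → NeighbourShape s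
    neighbour-shape s s≢ = by-role (r s) refl
      where
      by-role : ∀ ρ → r s ≡ ρ → NeighbourShape s
      by-role isolated     rs = contradiction rs s≢
      by-role (paired z)   rs = paired-end z rs
      by-role (leaf z)     rs = leaf-end z rs
      by-role (cherry a b) rs = two-neighbours a b (proj₁ (cherry-leaves rs))
        (names⇒roleAdj rs (∨-introˡ _ (==-refl a))) (names⇒roleAdj rs (∨-introʳ (a == b) (==-refl b)))
      by-role (star a b c) rs =
        let (a≢b , _ , _ , ra , rb , _) = star-leaves rs
        in  two-neighbours a b a≢b (named⇒roleAdj ra (==-refl s)) (named⇒roleAdj rb (==-refl s))
      by-role (triangle p q) rs = two-neighbours p q (proj₁ (proj₂ (triangle-next rs)))
        (names⇒roleAdj rs (∨-introˡ _ (==-refl p))) (names⇒roleAdj rs (∨-introʳ (p == q) (==-refl q)))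

    sole-neighbour : ∀ {s z} → r s ≡ paired z ⊎ r s ≡ leaf z → roleAdj r s z ≡ true
    sole-neighbour (inj₁ rs) = names⇒roleAdj rs (==-refl _)
    sole-neighbour (inj₂ rs) = names⇒roleAdj rs (==-refl _)

    partner-only : ∀ {s z t} → r s ≡ paired z → roleAdj r t z ≡ true → t ≡ s
    partner-only {s} {z} {t} rs tz with roleAdj⇒neighbour z t (trans (roleAdj-sym r z t) tz)
    ... | z~t rewrite proj₂ (paired-partner rs) = z~t

module _ {n : ℕ} where

  Represents : Graph n → Roles n → Set
  Represents G r = ∀ a b → adj G a b ≡ roleAdj r a b

  -- `adj ((u , v) ∷ G) a b` unfolds definitionally to `isEdge u v a b ∨ adj G a b`.
  isEdge : Fin n → Fin n → Fin n → Fin n → Bool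
  isEdge u v a b = (u == a ∧ v == b) ∨ (u == b ∧ v == a)

  isEdge-sound : ∀ u v a b → isEdge u v a b ≡ true → (a ≡ u × b ≡ v) ⊎ (a ≡ v × b ≡ u)
  isEdge-sound u v a b e with ∨-elim e
  ... | inj₁ p = let (ua , vb) = ∧-elim p in inj₁ (sym (==-sound ua) , sym (==-sound vb))
  ... | inj₂ p = let (ub , va) = ∧-elim p in inj₂ (sym (==-sound va) , sym (==-sound ub))

  isEdge-forward : ∀ u v → isEdge u v u v ≡ true
  isEdge-forward u v rewrite ==-refl u | ==-refl v = refl

  isEdge-backward : ∀ u v → isEdge u v v u ≡ true
  isEdge-backward u v rewrite ==-refl u | ==-refl v = ∨-zeroʳ _

  isEdge-sym : ∀ u v a b → isEdge u v a b ≡ isEdge u v b a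
  isEdge-sym u v a b = ∨-comm (u == a ∧ v == b) (u == b ∧ v == a)

  isEdge-flip : ∀ u v a b → isEdge v u a b ≡ isEdge u v a b
  isEdge-flip u v a b =
    trans (cong₂ _∨_ (∧-comm (v == a) (u == b)) (∧-comm (v == b) (u == a))) (∨-comm (u == b ∧ v == a) _)

  represents-flip : ∀ {G r} u v → Represents ((u , v) ∷ G) r → Represents ((v , u) ∷ G) r
  represents-flip {G} u v rep a b = trans (cong (_∨ adj G a b) (isEdge-flip u v a b)) (rep a b)

  represents-extend : ∀ {G r r'} u v → Represents G r →
    (∀ x y → names (r x) y ≡ true → roleAdj r' x y ≡ true) →
    (∀ x y → names (r' x) y ≡ true → (isEdge u v x y ∨ roleAdj r x y) ≡ true) →
    roleAdj r' u v ≡ true → Represents ((u , v) ∷ G) r'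
  represents-extend {G} {r} {r'} u v rep kept new uv a b =
    trans (cong (isEdge u v a b ∨_) (rep a b)) (⇔→≡ (mk⇔ to from))
    where
    to : (isEdge u v a b ∨ roleAdj r a b) ≡ true → roleAdj r' a b ≡ true
    to h with ∨-elim h
    ... | inj₁ e with isEdge-sound u v a b e
    ...   | inj₁ (refl , refl) = uv
    ...   | inj₂ (refl , refl) = trans (roleAdj-sym r' v u) uv
    to h | inj₂ old with ∨-elim old
    ...   | inj₁ a→b = kept a b a→b
    ...   | inj₂ b→a = trans (roleAdj-sym r' a b) (kept b a b→a)
    from : roleAdj r' a b ≡ true → (isEdge u v a b ∨ roleAdj r a b) ≡ true
    from h with ∨-elim h
    ... | inj₁ a→b = new a b a→b
    ... | inj₂ b→a rewrite isEdge-sym u v a b | roleAdj-sym r a b = new b a b→a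

  represented-P4Free : ∀ {G r} → WellFormed r → Represents G r → P4Free G
  represented-P4Free {G} {r} wf rep a b c d D ab bc cd =
    WellFormedRoles.roleAdj-P4Free wf a b c d D
      (trans (sym (rep a b)) ab) (trans (sym (rep b c)) bc) (trans (sym (rep c d)) cd)

  infixl 6 _[_≔_]
  _[_≔_] : Roles n → Fin n → Role n → Roles n
  r [ v ≔ ρ ] = updateAt r v (const ρ)

  ≔-updates : ∀ r v ρ → (r [ v ≔ ρ ]) v ≡ ρ
  ≔-updates r v ρ = updateAt-updates v r

  ≔-minimal : ∀ r {v} ρ {x} → x ≢ v → (r [ v ≔ ρ ]) x ≡ r x
  ≔-minimal r {v} ρ {x} x≢v = updateAt-minimal x v r x≢v

module _ {n : ℕ} where

  indicator : Bool → ℕ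
  indicator true  = 1
  indicator false = 0

  -- A K₂ is counted at its endpoint with the smaller index.
  contribution : Fin n → Role n → Census
  contribution x isolated       = census 1 0 0 0
  contribution x (paired p)     = census 0 (indicator (toℕ x <ᵇ toℕ p)) 0 0
  contribution x (cherry _ _)   = census 0 0 1 0
  contribution x (star _ _ _)   = census 0 0 0 1
  contribution x (leaf _)       = ∅
  contribution x (triangle _ _) = ∅

  censusOf : Roles n → Census
  censusOf r = total λ x → contribution x (r x)

  census-update : ∀ r v ρ →
    Changed (contribution v (r v)) (contribution v ρ) (censusOf r) (censusOf (r [ v ≔ ρ ]))
  census-update r v ρ =
    subst (λ σ → Changed (contribution v (r v)) (contribution v σ) (censusOf r) (censusOf (r [ v ≔ ρ ])))
          (≔-updates r v ρ)
          (total-changed _ _ v λ x x≢v → cong (contribution x) (sym (≔-minimal r ρ x≢v)))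

  pair-counted-once : ∀ {u v : Fin n} → u ≢ v →
                      indicator (toℕ u <ᵇ toℕ v) + indicator (toℕ v <ᵇ toℕ u) ≡ 1
  pair-counted-once {u} {v} u≢v with <-cmp (toℕ u) (toℕ v)
  ... | tri< u<v _ v≮u rewrite <ᵇ-true u<v | <ᵇ-false v≮u = refl
  ... | tri≈ _ u=v _   = contradiction (toℕ-injective u=v) u≢v
  ... | tri> u≮v _ v<u rewrite <ᵇ-false u≮v | <ᵇ-true v<u = refl

  isolated-witness : ∀ r → 1 ≤ #isolated (censusOf r) → ∃[ x ] r x ≡ isolated
  isolated-witness r h with total-witness #isolated (λ _ _ → refl) refl _ h
  ... | x , _ with r x in rx
  ... | isolated = x , rx

  two-isolated-witness : ∀ r → 2 ≤ #isolated (censusOf r) →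
                         ∃[ x ] ∃[ y ] x ≢ y × r x ≡ isolated × r y ≡ isolated
  two-isolated-witness r h with total-two #isolated (λ _ _ → refl) refl _ h
  ... | inj₁ (x , hx) with r x
  ...   | isolated with s≤s () ← hx
  two-isolated-witness r h | inj₂ (x , y , x≢y , _ , _) with r x in rx | r y in ry
  ... | isolated | isolated = x , y , x≢y , rx , ry

  paired-witness : ∀ r → 1 ≤ #pairs (censusOf r) → ∃[ x ] ∃[ p ] r x ≡ paired p
  paired-witness r h with total-witness #pairs (λ _ _ → refl) refl _ h
  ... | x , _ with r x in rx
  ... | paired p = x , p , rx

  cherry-witness : ∀ r → 1 ≤ #cherries (censusOf r) → ∃[ x ] ∃[ a ] ∃[ b ] r x ≡ cherry a b
  cherry-witness r h with total-witness #cherries (λ _ _ → refl) refl _ h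
  ... | x , _ with r x in rx
  ... | cherry a b = x , a , b , rx

  star-counted : ∀ {r v a b c} → r v ≡ star a b c → 1 ≤ #stars (censusOf r)
  star-counted {r} {v} rv = ≤-trans (subst (λ ρ → 1 ≤ #stars (contribution v ρ)) (sym rv) (s≤s z≤n))
                                     (total-≥ #stars (λ _ _ → refl) refl (λ x → contribution x (r x)) v)

  star-witness : ∀ r → 1 ≤ #stars (censusOf r) → ∃[ x ] ∃[ a ] ∃[ b ] ∃[ c ] r x ≡ star a b c
  star-witness r h with total-witness #stars (λ _ _ → refl) refl _ h
  ... | x , _ with r x in rx
  ... | star a b c = x , a , b , c , rx

-- The five moves

module _ {n : ℕ} where

  record Extension (G : Graph n) (e : Fin n × Fin n) : Set where
    constructor extension
    field
      roles       : Roles n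
      well-formed : WellFormed roles
      represents  : Represents (e ∷ G) roles

  open Extension public

  module Join {G : Graph n} {r : Roles n} (wf : WellFormed r) (rep : Represents G r)
              {u v : Fin n} (ru : r u ≡ isolated) (rv : r v ≡ isolated) (u≢v : u ≢ v) where
    open WellFormed wf

    r₁ r' : Roles n
    r₁ = r [ u ≔ paired v ]
    r' = r₁ [ v ≔ paired u ]

    data View (x : Fin n) : Set where
      at-u      : x ≡ u → r' x ≡ paired v → View x
      at-v      : x ≡ v → r' x ≡ paired u → View x
      elsewhere : x ≢ u → x ≢ v → r' x ≡ r x → View x

    view : ∀ x → View x
    view x with x ≟ v
    ... | yes refl = at-v refl (≔-updates r₁ v _)
    ... | no x≢v with x ≟ u
    ...   | yes refl = at-u refl (trans (≔-minimal r₁ _ x≢v) (≔-updates r u _))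
    ...   | no x≢u   = elsewhere x≢u x≢v (trans (≔-minimal r₁ _ x≢v) (≔-minimal r _ x≢u))

    unchanged : ∀ x {ρ} → r x ≡ ρ → ρ ≢ isolated → r' x ≡ ρ
    unchanged x rx ρ≢ with view x
    ... | at-u refl _       = contradiction (trans (sym rx) ru) ρ≢
    ... | at-v refl _       = contradiction (trans (sym rx) rv) ρ≢
    ... | elsewhere _ _ r'x = trans r'x rx

    r'u : r' u ≡ paired v
    r'u with view u
    ... | at-u _ e          = e
    ... | at-v u≡v _        = contradiction u≡v u≢v
    ... | elsewhere u≢u _ _ = contradiction refl u≢u

    r'v : r' v ≡ paired u
    r'v with view v
    ... | at-u v≡u _        = contradiction (sym v≡u) u≢v
    ... | at-v _ e          = e
    ... | elsewhere _ v≢v _ = contradiction refl v≢v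

    paired-partner' : ∀ x {p} → r' x ≡ paired p → x ≢ p × r' p ≡ paired x
    paired-partner' x e with view x
    ... | at-u refl e' with trans (sym e') e
    ...   | refl = u≢v , r'v
    paired-partner' x e | at-v refl e' with trans (sym e') e
    ...   | refl = u≢v ∘ sym , r'u
    paired-partner' x {p} e | elsewhere _ _ e' =
      let (x≢p , rp) = paired-partner (trans (sym e') e) in x≢p , unchanged p rp λ ()

    cherry-leaves' : ∀ x {a b} → r' x ≡ cherry a b →
      a ≢ b × r' a ≡ leaf x × r' b ≡ leaf x × (∀ z → r' z ≡ leaf x → z ≡ a ⊎ z ≡ b)
    cherry-leaves' x e with view x
    ... | at-u _ e' with () ← trans (sym e') e
    ... | at-v _ e' with () ← trans (sym e') e
    ... | elsewhere _ _ e' =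
      let (a≢b , ra , rb , only) = cherry-leaves (trans (sym e') e)
      in  a≢b , unchanged _ ra (λ ()) , unchanged _ rb (λ ()) , λ z rz → only z (leaf-of z rz)
      where
      leaf-of : ∀ z → r' z ≡ leaf x → r z ≡ leaf x
      leaf-of z rz with view z
      ... | at-u _ e'' with () ← trans (sym e'') rz
      ... | at-v _ e'' with () ← trans (sym e'') rz
      ... | elsewhere _ _ e'' = trans (sym e'') rz

    star-leaves' : ∀ x {a b c} → r' x ≡ star a b c →
      a ≢ b × a ≢ c × b ≢ c × r' a ≡ leaf x × r' b ≡ leaf x × r' c ≡ leaf x
    star-leaves' x e with view x
    ... | at-u _ e' with () ← trans (sym e') e
    ... | at-v _ e' with () ← trans (sym e') e
    ... | elsewhere _ _ e' =
      let (a≢b , a≢c , b≢c , ra , rb , rc) = star-leaves (trans (sym e') e)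
      in  a≢b , a≢c , b≢c , unchanged _ ra (λ ()) , unchanged _ rb (λ ()) , unchanged _ rc (λ ())

    leaf-centre' : ∀ x {c} → r' x ≡ leaf c → IsCentre (r' c)
    leaf-centre' x e with view x
    ... | at-u _ e' with () ← trans (sym e') e
    ... | at-v _ e' with () ← trans (sym e') e
    ... | elsewhere _ _ e' with centre-role wf (trans (sym e') e)
    ...   | inj₁ (_ , _ , rc)     rewrite unchanged _ rc (λ ()) = tt
    ...   | inj₂ (_ , _ , _ , rc) rewrite unchanged _ rc (λ ()) = tt

    triangle-next' : ∀ x {p q} → r' x ≡ triangle p q → x ≢ p × p ≢ q × q ≢ x × r' p ≡ triangle q x
    triangle-next' x e with view x
    ... | at-u _ e' with () ← trans (sym e') e
    ... | at-v _ e' with () ← trans (sym e') e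
    ... | elsewhere _ _ e' =
      let (x≢p , p≢q , q≢x , rp) = triangle-next (trans (sym e') e)
      in  x≢p , p≢q , q≢x , unchanged _ rp λ ()

    well-formed' : WellFormed r'
    well-formed' = record
      { paired-partner = λ {x} → paired-partner' x
      ; cherry-leaves  = λ {x} → cherry-leaves' x
      ; star-leaves    = λ {x} → star-leaves' x
      ; leaf-centre    = λ {x} → leaf-centre' x
      ; triangle-next  = λ {x} → triangle-next' x
      }

    kept : ∀ x y → names (r x) y ≡ true → roleAdj r' x y ≡ true
    kept x y x→y with r x in rx
    ... | isolated with () ← x→y
    ... | paired _     rewrite unchanged x rx (λ ()) = ∨-introˡ _ x→y
    ... | cherry _ _   rewrite unchanged x rx (λ ()) = ∨-introˡ _ x→y
    ... | star _ _ _   rewrite unchanged x rx (λ ()) = ∨-introˡ _ x→y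
    ... | leaf _       rewrite unchanged x rx (λ ()) = ∨-introˡ _ x→y
    ... | triangle _ _ rewrite unchanged x rx (λ ()) = ∨-introˡ _ x→y

    introduced : ∀ x y → names (r' x) y ≡ true → (isEdge u v x y ∨ roleAdj r x y) ≡ true
    introduced x y x→y with view x
    ... | at-u refl e rewrite e with ==-sound x→y
    ...   | refl = ∨-introˡ _ (isEdge-forward u v)
    introduced x y x→y | at-v refl e rewrite e with ==-sound x→y
    ...   | refl = ∨-introˡ _ (isEdge-backward u v)
    introduced x y x→y | elsewhere _ _ e rewrite e = ∨-introʳ (isEdge u v x y) (∨-introˡ _ x→y)

    extended : Extension G (u , v)
    extended = extension r' well-formed' (represents-extend {G = G} {r = r} {r' = r'} u v rep kept introduced joined)
      where
      joined : roleAdj r' u v ≡ true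
      joined rewrite r'u = ∨-introˡ _ (==-refl v)

    census-changed : Changed (census 2 0 0 0) (census 0 1 0 0) (censusOf r) (censusOf r')
    census-changed = subst₂ (λ o a → Changed o a (censusOf r) (censusOf r')) removed added
                     (changed-trans (census-update r u _) (census-update r₁ v _))
      where
      removed : contribution u (r u) ⊕ contribution v (r₁ v) ≡ census 2 0 0 0
      removed rewrite ru | ≔-minimal r (paired v) (u≢v ∘ sym) | rv = refl
      added : contribution u (paired v) ⊕ contribution v (paired u) ≡ census 0 1 0 0
      added = cong (λ k → census 0 k 0 0) (pair-counted-once u≢v)

  module Extend {G : Graph n} {r : Roles n} (wf : WellFormed r) (rep : Represents G r)
                {u v p : Fin n} (ru : r u ≡ isolated) (rv : r v ≡ paired p) where
    open WellFormed wf

    v≢p : v ≢ p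
    v≢p = proj₁ (paired-partner rv)
    rp : r p ≡ paired v
    rp = proj₂ (paired-partner rv)
    u≢v : u ≢ v
    u≢v = ≢-by-role ru rv λ ()
    u≢p : u ≢ p
    u≢p = ≢-by-role ru rp λ ()

    r₁ r₂ r' : Roles n
    r₁ = r [ u ≔ leaf v ]
    r₂ = r₁ [ v ≔ cherry p u ]
    r' = r₂ [ p ≔ leaf v ]

    data View (x : Fin n) : Set where
      at-u      : x ≡ u → r' x ≡ leaf v → View x
      at-v      : x ≡ v → r' x ≡ cherry p u → View x
      at-p      : x ≡ p → r' x ≡ leaf v → View x
      elsewhere : x ≢ u → x ≢ v → x ≢ p → r' x ≡ r x → View x

    view : ∀ x → View x
    view x with x ≟ p
    ... | yes refl = at-p refl (≔-updates r₂ p _)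
    ... | no x≢p with x ≟ v
    ...   | yes refl = at-v refl (trans (≔-minimal r₂ _ x≢p) (≔-updates r₁ v _))
    ...   | no x≢v with x ≟ u
    ...     | yes refl = at-u refl (trans (≔-minimal r₂ _ x≢p) (trans (≔-minimal r₁ _ x≢v) (≔-updates r u _)))
    ...     | no x≢u   = elsewhere x≢u x≢v x≢p
                           (trans (≔-minimal r₂ _ x≢p) (trans (≔-minimal r₁ _ x≢v) (≔-minimal r _ x≢u)))

    r'u : r' u ≡ leaf v
    r'u with view u
    ... | at-u _ e            = e
    ... | at-v u≡v _          = contradiction u≡v u≢v
    ... | at-p u≡p _          = contradiction u≡p u≢p
    ... | elsewhere u≢u _ _ _ = contradiction refl u≢u

    r'v : r' v ≡ cherry p u
    r'v with view v
    ... | at-u v≡u _          = contradiction (sym v≡u) u≢v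
    ... | at-v _ e            = e
    ... | at-p v≡p _          = contradiction v≡p v≢p
    ... | elsewhere _ v≢v _ _ = contradiction refl v≢v

    r'p : r' p ≡ leaf v
    r'p with view p
    ... | at-u p≡u _          = contradiction (sym p≡u) u≢p
    ... | at-v p≡v _          = contradiction (sym p≡v) v≢p
    ... | at-p _ e            = e
    ... | elsewhere _ _ p≢p _ = contradiction refl p≢p

    unchanged : ∀ x {ρ} → r x ≡ ρ → ρ ≢ isolated → (∀ q → ρ ≢ paired q) → r' x ≡ ρ
    unchanged x rx ρ≢ ρ≢paired with view x
    ... | at-u refl _         = contradiction (trans (sym rx) ru) ρ≢
    ... | at-v refl _         = contradiction (trans (sym rx) rv) (ρ≢paired p)
    ... | at-p refl _         = contradiction (trans (sym rx) rp) (ρ≢paired v)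
    ... | elsewhere _ _ _ r'x = trans r'x rx

    paired-partner' : ∀ x {q} → r' x ≡ paired q → x ≢ q × r' q ≡ paired x
    paired-partner' x e with view x
    ... | at-u _ e' with () ← trans (sym e') e
    ... | at-v _ e' with () ← trans (sym e') e
    ... | at-p _ e' with () ← trans (sym e') e
    paired-partner' x {q} e | elsewhere _ x≢v x≢p e' with paired-partner (trans (sym e') e)
    ... | x≢q , rq with view q
    ...   | at-u refl _         with () ← trans (sym ru) rq
    ...   | at-v refl _         = contradiction (sym (paired-injective (trans (sym rv) rq))) x≢p
    ...   | at-p refl _         = contradiction (sym (paired-injective (trans (sym rp) rq))) x≢v
    ...   | elsewhere _ _ _ r'q = x≢q , trans r'q rq

    cherry-leaves' : ∀ x {a b} → r' x ≡ cherry a b →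
      a ≢ b × r' a ≡ leaf x × r' b ≡ leaf x × (∀ z → r' z ≡ leaf x → z ≡ a ⊎ z ≡ b)
    cherry-leaves' x e with view x
    ... | at-u _ e' with () ← trans (sym e') e
    ... | at-p _ e' with () ← trans (sym e') e
    ... | at-v refl e' with trans (sym e') e
    ...   | refl = u≢p ∘ sym , r'p , r'u , only
      where
      only : ∀ z → r' z ≡ leaf v → z ≡ p ⊎ z ≡ u
      only z rz with view z
      ... | at-u z≡u _ = inj₂ z≡u
      ... | at-v _ e'' with () ← trans (sym e'') rz
      ... | at-p z≡p _ = inj₁ z≡p
      ... | elsewhere _ _ _ e'' with centre-role wf (trans (sym e'') rz)
      ...   | inj₁ (_ , _ , rv')     with () ← trans (sym rv) rv'
      ...   | inj₂ (_ , _ , _ , rv') with () ← trans (sym rv) rv'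
    cherry-leaves' x e | elsewhere _ x≢v _ e' =
      let (a≢b , ra , rb , only) = cherry-leaves (trans (sym e') e)
      in  a≢b , unchanged _ ra (λ ()) (λ _ ()) , unchanged _ rb (λ ()) (λ _ ()) , λ z rz → only z (leaf-of z rz)
      where
      leaf-of : ∀ z → r' z ≡ leaf x → r z ≡ leaf x
      leaf-of z rz with view z
      ... | at-u _ e''          = contradiction (sym (leaf-injective (trans (sym e'') rz))) x≢v
      ... | at-v _ e'' with () ← trans (sym e'') rz
      ... | at-p _ e''          = contradiction (sym (leaf-injective (trans (sym e'') rz))) x≢v
      ... | elsewhere _ _ _ e'' = trans (sym e'') rz

    star-leaves' : ∀ x {a b c} → r' x ≡ star a b c →
      a ≢ b × a ≢ c × b ≢ c × r' a ≡ leaf x × r' b ≡ leaf x × r' c ≡ leaf x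
    star-leaves' x e with view x
    ... | at-u _ e' with () ← trans (sym e') e
    ... | at-v _ e' with () ← trans (sym e') e
    ... | at-p _ e' with () ← trans (sym e') e
    ... | elsewhere _ _ _ e' =
      let (a≢b , a≢c , b≢c , ra , rb , rc) = star-leaves (trans (sym e') e)
      in  a≢b , a≢c , b≢c , unchanged _ ra (λ ()) (λ _ ()) , unchanged _ rb (λ ()) (λ _ ())
                          , unchanged _ rc (λ ()) (λ _ ())

    leaf-centre' : ∀ x {c} → r' x ≡ leaf c → IsCentre (r' c)
    leaf-centre' x e with view x
    ... | at-u _ e' with trans (sym e') e
    ...   | refl rewrite r'v = tt
    leaf-centre' x e | at-v _ e' with () ← trans (sym e') e
    leaf-centre' x e | at-p _ e' with trans (sym e') e
    ...   | refl rewrite r'v = tt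
    leaf-centre' x e | elsewhere _ _ _ e' with centre-role wf (trans (sym e') e)
    ...   | inj₁ (_ , _ , rc)     rewrite unchanged _ rc (λ ()) (λ _ ()) = tt
    ...   | inj₂ (_ , _ , _ , rc) rewrite unchanged _ rc (λ ()) (λ _ ()) = tt

    triangle-next' : ∀ x {a b} → r' x ≡ triangle a b → x ≢ a × a ≢ b × b ≢ x × r' a ≡ triangle b x
    triangle-next' x e with view x
    ... | at-u _ e' with () ← trans (sym e') e
    ... | at-v _ e' with () ← trans (sym e') e
    ... | at-p _ e' with () ← trans (sym e') e
    ... | elsewhere _ _ _ e' =
      let (x≢a , a≢b , b≢x , ra) = triangle-next (trans (sym e') e)
      in  x≢a , a≢b , b≢x , unchanged _ ra (λ ()) (λ _ ())

    well-formed' : WellFormed r'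
    well-formed' = record
      { paired-partner = λ {x} → paired-partner' x
      ; cherry-leaves  = λ {x} → cherry-leaves' x
      ; star-leaves    = λ {x} → star-leaves' x
      ; leaf-centre    = λ {x} → leaf-centre' x
      ; triangle-next  = λ {x} → triangle-next' x
      }

    kept : ∀ x y → names (r x) y ≡ true → roleAdj r' x y ≡ true
    kept x y x→y with view x
    ... | at-u refl _ rewrite ru with () ← x→y
    ... | at-v refl _ rewrite rv with ==-sound x→y
    ...   | refl rewrite r'v = ∨-introˡ _ (∨-introˡ _ (==-refl p))
    kept x y x→y | at-p refl _ rewrite rp with ==-sound x→y
    ...   | refl rewrite r'p = ∨-introˡ _ (==-refl v)
    kept x y x→y | elsewhere _ _ _ e rewrite e = ∨-introˡ _ x→y

    introduced : ∀ x y → names (r' x) y ≡ true → (isEdge u v x y ∨ roleAdj r x y) ≡ true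
    introduced x y x→y with view x
    ... | at-u refl e rewrite e with ==-sound x→y
    ...   | refl = ∨-introˡ _ (isEdge-forward u v)
    introduced x y x→y | at-v refl e rewrite e with ==-either p u y x→y
    ...   | inj₁ refl =
      ∨-introʳ (isEdge u v v p) (∨-introˡ _ (subst (λ ρ → names ρ p ≡ true) (sym rv) (==-refl p)))
    ...   | inj₂ refl = ∨-introˡ _ (isEdge-backward u v)
    introduced x y x→y | at-p refl e rewrite e with ==-sound x→y
    ...   | refl = ∨-introʳ (isEdge u v p v) (∨-introˡ _ (subst (λ ρ → names ρ v ≡ true) (sym rp) (==-refl v)))
    introduced x y x→y | elsewhere _ _ _ e rewrite e = ∨-introʳ (isEdge u v x y) (∨-introˡ _ x→y)

    extended : Extension G (u , v)
    extended = extension r' well-formed' (represents-extend {G = G} {r = r} {r' = r'} u v rep kept introduced joined)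
      where
      joined : roleAdj r' u v ≡ true
      joined rewrite r'u = ∨-introˡ _ (==-refl v)

    census-changed : Changed (census 1 1 0 0) (census 0 0 1 0) (censusOf r) (censusOf r')
    census-changed =
      subst (λ o → Changed o (census 0 0 1 0) (censusOf r) (censusOf r')) removed
            (changed-trans (changed-trans (census-update r u _) (census-update r₁ v _)) (census-update r₂ p _))
      where
      removed : (contribution u (r u) ⊕ contribution v (r₁ v)) ⊕ contribution p (r₂ p) ≡ census 1 1 0 0
      removed rewrite ru | ≔-minimal r (leaf v) (u≢v ∘ sym) | rv
                    | ≔-minimal r₁ (cherry p u) (v≢p ∘ sym) | ≔-minimal r (leaf v) (u≢p ∘ sym) | rp =
        cong (λ k → census 1 k 0 0) (pair-counted-once v≢p)

  module Grow {G : Graph n} {r : Roles n} (wf : WellFormed r) (rep : Represents G r)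
              {u v a b : Fin n} (ru : r u ≡ isolated) (rv : r v ≡ cherry a b) where
    open WellFormed wf

    a≢b : a ≢ b
    a≢b = proj₁ (cherry-leaves rv)
    ra : r a ≡ leaf v
    ra = proj₁ (proj₂ (cherry-leaves rv))
    rb : r b ≡ leaf v
    rb = proj₁ (proj₂ (proj₂ (cherry-leaves rv)))
    u≢v : u ≢ v
    u≢v = ≢-by-role ru rv λ ()

    r₁ r' : Roles n
    r₁ = r [ u ≔ leaf v ]
    r' = r₁ [ v ≔ star a b u ]

    data View (x : Fin n) : Set where
      at-u      : x ≡ u → r' x ≡ leaf v → View x
      at-v      : x ≡ v → r' x ≡ star a b u → View x
      elsewhere : x ≢ u → x ≢ v → r' x ≡ r x → View x

    view : ∀ x → View x
    view x with x ≟ v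
    ... | yes refl = at-v refl (≔-updates r₁ v _)
    ... | no x≢v with x ≟ u
    ...   | yes refl = at-u refl (trans (≔-minimal r₁ _ x≢v) (≔-updates r u _))
    ...   | no x≢u   = elsewhere x≢u x≢v (trans (≔-minimal r₁ _ x≢v) (≔-minimal r _ x≢u))

    r'u : r' u ≡ leaf v
    r'u with view u
    ... | at-u _ e          = e
    ... | at-v u≡v _        = contradiction u≡v u≢v
    ... | elsewhere u≢u _ _ = contradiction refl u≢u

    r'v : r' v ≡ star a b u
    r'v with view v
    ... | at-u v≡u _        = contradiction (sym v≡u) u≢v
    ... | at-v _ e          = e
    ... | elsewhere _ v≢v _ = contradiction refl v≢v

    unchanged : ∀ x {ρ} → r x ≡ ρ → ρ ≢ isolated → (∀ c d → ρ ≢ cherry c d) → r' x ≡ ρ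
    unchanged x rx ρ≢ ρ≢cherry with view x
    ... | at-u refl _       = contradiction (trans (sym rx) ru) ρ≢
    ... | at-v refl _       = contradiction (trans (sym rx) rv) (ρ≢cherry a b)
    ... | elsewhere _ _ r'x = trans r'x rx

    paired-partner' : ∀ x {q} → r' x ≡ paired q → x ≢ q × r' q ≡ paired x
    paired-partner' x e with view x
    ... | at-u _ e' with () ← trans (sym e') e
    ... | at-v _ e' with () ← trans (sym e') e
    ... | elsewhere _ _ e' =
      let (x≢q , rq) = paired-partner (trans (sym e') e) in x≢q , unchanged _ rq (λ ()) (λ _ _ ())

    cherry-leaves' : ∀ x {c d} → r' x ≡ cherry c d →
      c ≢ d × r' c ≡ leaf x × r' d ≡ leaf x × (∀ z → r' z ≡ leaf x → z ≡ c ⊎ z ≡ d)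
    cherry-leaves' x e with view x
    ... | at-u _ e' with () ← trans (sym e') e
    ... | at-v _ e' with () ← trans (sym e') e
    ... | elsewhere _ x≢v e' =
      let (c≢d , rc , rd , only) = cherry-leaves (trans (sym e') e)
      in  c≢d , unchanged _ rc (λ ()) (λ _ _ ()) , unchanged _ rd (λ ()) (λ _ _ ()) , λ z rz → only z (leaf-of z rz)
      where
      leaf-of : ∀ z → r' z ≡ leaf x → r z ≡ leaf x
      leaf-of z rz with view z
      ... | at-u _ e''        = contradiction (sym (leaf-injective (trans (sym e'') rz))) x≢v
      ... | at-v _ e'' with () ← trans (sym e'') rz
      ... | elsewhere _ _ e'' = trans (sym e'') rz

    star-leaves' : ∀ x {c d f} → r' x ≡ star c d f →
      c ≢ d × c ≢ f × d ≢ f × r' c ≡ leaf x × r' d ≡ leaf x × r' f ≡ leaf x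
    star-leaves' x e with view x
    ... | at-u _ e' with () ← trans (sym e') e
    ... | at-v refl e' with trans (sym e') e
    ...   | refl = a≢b , ≢-by-role ra ru (λ ()) , ≢-by-role rb ru (λ ())
                 , unchanged _ ra (λ ()) (λ _ _ ()) , unchanged _ rb (λ ()) (λ _ _ ()) , r'u
    star-leaves' x e | elsewhere _ _ e' =
      let (c≢d , c≢f , d≢f , rc , rd , rf) = star-leaves (trans (sym e') e)
      in  c≢d , c≢f , d≢f , unchanged _ rc (λ ()) (λ _ _ ()) , unchanged _ rd (λ ()) (λ _ _ ())
                          , unchanged _ rf (λ ()) (λ _ _ ())

    leaf-centre' : ∀ x {c} → r' x ≡ leaf c → IsCentre (r' c)
    leaf-centre' x e with view x
    ... | at-u _ e' with trans (sym e') e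
    ...   | refl rewrite r'v = tt
    leaf-centre' x e | at-v _ e' with () ← trans (sym e') e
    leaf-centre' x {c} e | elsewhere _ _ e' with view c | leaf-centre (trans (sym e') e)
    ...   | at-u refl _       | centre rewrite ru = ⊥-elim centre
    ...   | at-v refl r'c     | _ rewrite r'c = tt
    ...   | elsewhere _ _ r'c | centre rewrite r'c = centre

    triangle-next' : ∀ x {c d} → r' x ≡ triangle c d → x ≢ c × c ≢ d × d ≢ x × r' c ≡ triangle d x
    triangle-next' x e with view x
    ... | at-u _ e' with () ← trans (sym e') e
    ... | at-v _ e' with () ← trans (sym e') e
    ... | elsewhere _ _ e' =
      let (x≢c , c≢d , d≢x , rc) = triangle-next (trans (sym e') e)
      in  x≢c , c≢d , d≢x , unchanged _ rc (λ ()) (λ _ _ ())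

    well-formed' : WellFormed r'
    well-formed' = record
      { paired-partner = λ {x} → paired-partner' x
      ; cherry-leaves  = λ {x} → cherry-leaves' x
      ; star-leaves    = λ {x} → star-leaves' x
      ; leaf-centre    = λ {x} → leaf-centre' x
      ; triangle-next  = λ {x} → triangle-next' x
      }

    kept : ∀ x y → names (r x) y ≡ true → roleAdj r' x y ≡ true
    kept x y x→y with view x
    ... | at-u refl _ rewrite ru with () ← x→y
    ... | at-v refl _ rewrite rv with ==-either a b y x→y
    ...   | inj₁ refl rewrite unchanged a ra (λ ()) (λ _ _ ()) = ∨-introʳ (names (r' v) a) (==-refl v)
    ...   | inj₂ refl rewrite unchanged b rb (λ ()) (λ _ _ ()) = ∨-introʳ (names (r' v) b) (==-refl v)
    kept x y x→y | elsewhere _ _ e rewrite e = ∨-introˡ _ x→y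

    introduced : ∀ x y → names (r' x) y ≡ true → (isEdge u v x y ∨ roleAdj r x y) ≡ true
    introduced x y x→y with view x
    ... | at-u refl e rewrite e with ==-sound x→y
    ...   | refl = ∨-introˡ _ (isEdge-forward u v)
    introduced x y x→y | at-v refl e rewrite e with () ← x→y
    introduced x y x→y | elsewhere _ _ e rewrite e = ∨-introʳ (isEdge u v x y) (∨-introˡ _ x→y)

    extended : Extension G (u , v)
    extended = extension r' well-formed' (represents-extend {G = G} {r = r} {r' = r'} u v rep kept introduced joined)
      where
      joined : roleAdj r' u v ≡ true
      joined rewrite r'u = ∨-introˡ _ (==-refl v)

    census-changed : Changed (census 1 0 1 0) (census 0 0 0 1) (censusOf r) (censusOf r')
    census-changed =
      subst (λ o → Changed o (census 0 0 0 1) (censusOf r) (censusOf r')) removed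
            (changed-trans (census-update r u _) (census-update r₁ v _))
      where
      removed : contribution u (r u) ⊕ contribution v (r₁ v) ≡ census 1 0 1 0
      removed rewrite ru | ≔-minimal r (leaf v) (u≢v ∘ sym) | rv = refl

  module Attach {G : Graph n} {r : Roles n} (wf : WellFormed r) (rep : Represents G r)
                {u v a b c : Fin n} (ru : r u ≡ isolated) (rv : r v ≡ star a b c) where
    open WellFormed wf

    u≢v : u ≢ v
    u≢v = ≢-by-role ru rv λ ()

    r' : Roles n
    r' = r [ u ≔ leaf v ]

    data View (x : Fin n) : Set where
      at-u      : x ≡ u → r' x ≡ leaf v → View x
      elsewhere : x ≢ u → r' x ≡ r x → View x

    view : ∀ x → View x
    view x with x ≟ u
    ... | yes refl = at-u refl (≔-updates r u _)
    ... | no x≢u   = elsewhere x≢u (≔-minimal r _ x≢u)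

    r'v : r' v ≡ star a b c
    r'v = trans (≔-minimal r _ (u≢v ∘ sym)) rv

    unchanged : ∀ x {ρ} → r x ≡ ρ → ρ ≢ isolated → r' x ≡ ρ
    unchanged x rx ρ≢ with view x
    ... | at-u refl _     = contradiction (trans (sym rx) ru) ρ≢
    ... | elsewhere _ r'x = trans r'x rx

    paired-partner' : ∀ x {q} → r' x ≡ paired q → x ≢ q × r' q ≡ paired x
    paired-partner' x e with view x
    ... | at-u _ e' with () ← trans (sym e') e
    ... | elsewhere _ e' =
      let (x≢q , rq) = paired-partner (trans (sym e') e) in x≢q , unchanged _ rq λ ()

    cherry-leaves' : ∀ x {d f} → r' x ≡ cherry d f →
      d ≢ f × r' d ≡ leaf x × r' f ≡ leaf x × (∀ z → r' z ≡ leaf x → z ≡ d ⊎ z ≡ f)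
    cherry-leaves' x e with view x
    ... | at-u _ e' with () ← trans (sym e') e
    ... | elsewhere _ e' =
      let (d≢f , rd , rf , only) = cherry-leaves (trans (sym e') e)
      in  d≢f , unchanged _ rd (λ ()) , unchanged _ rf (λ ()) , λ z rz → only z (leaf-of z rz)
      where
      leaf-of : ∀ z → r' z ≡ leaf x → r z ≡ leaf x
      leaf-of z rz with view z
      ... | at-u _ e'' with leaf-injective (trans (sym e'') rz)
      ...   | refl with () ← trans (sym rv) (trans (sym e') e)
      leaf-of z rz | elsewhere _ e'' = trans (sym e'') rz

    star-leaves' : ∀ x {d f g} → r' x ≡ star d f g →
      d ≢ f × d ≢ g × f ≢ g × r' d ≡ leaf x × r' f ≡ leaf x × r' g ≡ leaf x
    star-leaves' x e with view x
    ... | at-u _ e' with () ← trans (sym e') e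
    ... | elsewhere _ e' =
      let (d≢f , d≢g , f≢g , rd , rf , rg) = star-leaves (trans (sym e') e)
      in  d≢f , d≢g , f≢g , unchanged _ rd (λ ()) , unchanged _ rf (λ ()) , unchanged _ rg (λ ())

    leaf-centre' : ∀ x {d} → r' x ≡ leaf d → IsCentre (r' d)
    leaf-centre' x e with view x
    ... | at-u _ e' with trans (sym e') e
    ...   | refl rewrite r'v = tt
    leaf-centre' x {d} e | elsewhere _ e' with view d | leaf-centre (trans (sym e') e)
    ...   | at-u refl _     | centre rewrite ru = ⊥-elim centre
    ...   | elsewhere _ r'd | centre rewrite r'd = centre

    triangle-next' : ∀ x {d f} → r' x ≡ triangle d f → x ≢ d × d ≢ f × f ≢ x × r' d ≡ triangle f x
    triangle-next' x e with view x
    ... | at-u _ e' with () ← trans (sym e') e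
    ... | elsewhere _ e' =
      let (x≢d , d≢f , f≢x , rd) = triangle-next (trans (sym e') e)
      in  x≢d , d≢f , f≢x , unchanged _ rd λ ()

    well-formed' : WellFormed r'
    well-formed' = record
      { paired-partner = λ {x} → paired-partner' x
      ; cherry-leaves  = λ {x} → cherry-leaves' x
      ; star-leaves    = λ {x} → star-leaves' x
      ; leaf-centre    = λ {x} → leaf-centre' x
      ; triangle-next  = λ {x} → triangle-next' x
      }

    kept : ∀ x y → names (r x) y ≡ true → roleAdj r' x y ≡ true
    kept x y x→y with view x
    ... | at-u refl _ rewrite ru with () ← x→y
    ... | elsewhere _ e rewrite e = ∨-introˡ _ x→y

    introduced : ∀ x y → names (r' x) y ≡ true → (isEdge u v x y ∨ roleAdj r x y) ≡ true
    introduced x y x→y with view x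
    ... | at-u refl e rewrite e with ==-sound x→y
    ...   | refl = ∨-introˡ _ (isEdge-forward u v)
    introduced x y x→y | elsewhere _ e rewrite e = ∨-introʳ (isEdge u v x y) (∨-introˡ _ x→y)

    extended : Extension G (u , v)
    extended = extension r' well-formed' (represents-extend {G = G} {r = r} {r' = r'} u v rep kept introduced joined)
      where
      joined : roleAdj r' u v ≡ true
      joined rewrite ≔-updates r u (leaf v) = ∨-introˡ _ (==-refl v)

    census-changed : Changed (census 1 0 0 0) ∅ (censusOf r) (censusOf r')
    census-changed = subst (λ o → Changed o ∅ (censusOf r) (censusOf r')) removed (census-update r u _)
      where
      removed : contribution u (r u) ≡ census 1 0 0 0
      removed rewrite ru = refl

  module Close {G : Graph n} {r : Roles n} (wf : WellFormed r) (rep : Represents G r)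
               {u v c : Fin n} (rc : r c ≡ cherry u v) where
    open WellFormed wf

    u≢v : u ≢ v
    u≢v = proj₁ (cherry-leaves rc)
    ru : r u ≡ leaf c
    ru = proj₁ (proj₂ (cherry-leaves rc))
    rv : r v ≡ leaf c
    rv = proj₁ (proj₂ (proj₂ (cherry-leaves rc)))
    only-leaves : ∀ z → r z ≡ leaf c → z ≡ u ⊎ z ≡ v
    only-leaves = proj₂ (proj₂ (proj₂ (cherry-leaves rc)))
    u≢c : u ≢ c
    u≢c = ≢-by-role ru rc λ ()
    v≢c : v ≢ c
    v≢c = ≢-by-role rv rc λ ()

    r₁ r₂ r' : Roles n
    r₁ = r [ u ≔ triangle v c ]
    r₂ = r₁ [ v ≔ triangle c u ]
    r' = r₂ [ c ≔ triangle u v ]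

    data View (x : Fin n) : Set where
      at-u      : x ≡ u → r' x ≡ triangle v c → View x
      at-v      : x ≡ v → r' x ≡ triangle c u → View x
      at-c      : x ≡ c → r' x ≡ triangle u v → View x
      elsewhere : x ≢ u → x ≢ v → x ≢ c → r' x ≡ r x → View x

    view : ∀ x → View x
    view x with x ≟ c
    ... | yes refl = at-c refl (≔-updates r₂ c _)
    ... | no x≢c with x ≟ v
    ...   | yes refl = at-v refl (trans (≔-minimal r₂ _ x≢c) (≔-updates r₁ v _))
    ...   | no x≢v with x ≟ u
    ...     | yes refl = at-u refl (trans (≔-minimal r₂ _ x≢c) (trans (≔-minimal r₁ _ x≢v) (≔-updates r u _)))
    ...     | no x≢u   = elsewhere x≢u x≢v x≢c
                           (trans (≔-minimal r₂ _ x≢c) (trans (≔-minimal r₁ _ x≢v) (≔-minimal r _ x≢u)))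

    r'u : r' u ≡ triangle v c
    r'u with view u
    ... | at-u _ e            = e
    ... | at-v u≡v _          = contradiction u≡v u≢v
    ... | at-c u≡c _          = contradiction u≡c u≢c
    ... | elsewhere u≢u _ _ _ = contradiction refl u≢u

    r'v : r' v ≡ triangle c u
    r'v with view v
    ... | at-u v≡u _          = contradiction (sym v≡u) u≢v
    ... | at-v _ e            = e
    ... | at-c v≡c _          = contradiction v≡c v≢c
    ... | elsewhere _ v≢v _ _ = contradiction refl v≢v

    r'c : r' c ≡ triangle u v
    r'c with view c
    ... | at-u c≡u _          = contradiction (sym c≡u) u≢c
    ... | at-v c≡v _          = contradiction (sym c≡v) v≢c
    ... | at-c _ e            = e
    ... | elsewhere _ _ c≢c _ = contradiction refl c≢c

    unchanged : ∀ x {ρ} → r x ≡ ρ → ρ ≢ leaf c → ρ ≢ cherry u v → r' x ≡ ρ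
    unchanged x rx ρ≢leaf ρ≢cherry with view x
    ... | at-u refl _         = contradiction (trans (sym rx) ru) ρ≢leaf
    ... | at-v refl _         = contradiction (trans (sym rx) rv) ρ≢leaf
    ... | at-c refl _         = contradiction (trans (sym rx) rc) ρ≢cherry
    ... | elsewhere _ _ _ r'x = trans r'x rx

    paired-partner' : ∀ x {q} → r' x ≡ paired q → x ≢ q × r' q ≡ paired x
    paired-partner' x e with view x
    ... | at-u _ e' with () ← trans (sym e') e
    ... | at-v _ e' with () ← trans (sym e') e
    ... | at-c _ e' with () ← trans (sym e') e
    ... | elsewhere _ _ _ e' =
      let (x≢q , rq) = paired-partner (trans (sym e') e) in x≢q , unchanged _ rq (λ ()) (λ ())

    cherry-leaves' : ∀ x {a b} → r' x ≡ cherry a b →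
      a ≢ b × r' a ≡ leaf x × r' b ≡ leaf x × (∀ z → r' z ≡ leaf x → z ≡ a ⊎ z ≡ b)
    cherry-leaves' x e with view x
    ... | at-u _ e' with () ← trans (sym e') e
    ... | at-v _ e' with () ← trans (sym e') e
    ... | at-c _ e' with () ← trans (sym e') e
    ... | elsewhere _ _ x≢c e' =
      let (a≢b , ra , rb , only) = cherry-leaves (trans (sym e') e)
      in  a≢b , unchanged _ ra (x≢c ∘ leaf-injective) (λ ()) , unchanged _ rb (x≢c ∘ leaf-injective) (λ ())
              , λ z rz → only z (leaf-of z rz)
      where
      leaf-of : ∀ z → r' z ≡ leaf x → r z ≡ leaf x
      leaf-of z rz with view z
      ... | at-u _ e'' with () ← trans (sym e'') rz
      ... | at-v _ e'' with () ← trans (sym e'') rz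
      ... | at-c _ e'' with () ← trans (sym e'') rz
      ... | elsewhere _ _ _ e'' = trans (sym e'') rz

    star-leaves' : ∀ x {a b d} → r' x ≡ star a b d →
      a ≢ b × a ≢ d × b ≢ d × r' a ≡ leaf x × r' b ≡ leaf x × r' d ≡ leaf x
    star-leaves' x e with view x
    ... | at-u _ e' with () ← trans (sym e') e
    ... | at-v _ e' with () ← trans (sym e') e
    ... | at-c _ e' with () ← trans (sym e') e
    ... | elsewhere _ _ x≢c e' =
      let (a≢b , a≢d , b≢d , ra , rb , rd) = star-leaves (trans (sym e') e)
      in  a≢b , a≢d , b≢d
        , unchanged _ ra (x≢c ∘ leaf-injective) (λ ()) , unchanged _ rb (x≢c ∘ leaf-injective) (λ ())
                          , unchanged _ rd (x≢c ∘ leaf-injective) (λ ())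

    leaf-centre' : ∀ x {d} → r' x ≡ leaf d → IsCentre (r' d)
    leaf-centre' x e with view x
    ... | at-u _ e' with () ← trans (sym e') e
    ... | at-v _ e' with () ← trans (sym e') e
    ... | at-c _ e' with () ← trans (sym e') e
    leaf-centre' x {d} e | elsewhere x≢u x≢v _ e' with view d | leaf-centre (trans (sym e') e)
    ... | at-u refl _         | centre rewrite ru = ⊥-elim centre
    ... | at-v refl _         | centre rewrite rv = ⊥-elim centre
    ... | at-c refl _         | _ with only-leaves x (trans (sym e') e)
    ...   | inj₁ x≡u = contradiction x≡u x≢u
    ...   | inj₂ x≡v = contradiction x≡v x≢v
    leaf-centre' x {d} e | elsewhere _ _ _ e' | elsewhere _ _ _ r'd | centre rewrite r'd = centre

    triangle-next' : ∀ x {a b} → r' x ≡ triangle a b → x ≢ a × a ≢ b × b ≢ x × r' a ≡ triangle b x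
    triangle-next' x e with view x
    ... | at-u refl e' with trans (sym e') e
    ...   | refl = u≢v , v≢c , u≢c ∘ sym , r'v
    triangle-next' x e | at-v refl e' with trans (sym e') e
    ...   | refl = v≢c , u≢c ∘ sym , u≢v , r'c
    triangle-next' x e | at-c refl e' with trans (sym e') e
    ...   | refl = u≢c ∘ sym , u≢v , v≢c , r'u
    triangle-next' x e | elsewhere _ _ _ e' =
      let (x≢a , a≢b , b≢x , ra) = triangle-next (trans (sym e') e)
      in  x≢a , a≢b , b≢x , unchanged _ ra (λ ()) (λ ())

    well-formed' : WellFormed r'
    well-formed' = record
      { paired-partner = λ {x} → paired-partner' x
      ; cherry-leaves  = λ {x} → cherry-leaves' x
      ; star-leaves    = λ {x} → star-leaves' x
      ; leaf-centre    = λ {x} → leaf-centre' x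
      ; triangle-next  = λ {x} → triangle-next' x
      }

    kept : ∀ x y → names (r x) y ≡ true → roleAdj r' x y ≡ true
    kept x y x→y with view x
    ... | at-u refl _ rewrite ru with ==-sound x→y
    ...   | refl rewrite r'u = ∨-introˡ _ (∨-introʳ (v == c) (==-refl c))
    kept x y x→y | at-v refl _ rewrite rv with ==-sound x→y
    ...   | refl rewrite r'v = ∨-introˡ _ (∨-introˡ _ (==-refl c))
    kept x y x→y | at-c refl _ rewrite rc | r'c = ∨-introˡ _ x→y
    kept x y x→y | elsewhere _ _ _ e rewrite e = ∨-introˡ _ x→y

    introduced : ∀ x y → names (r' x) y ≡ true → (isEdge u v x y ∨ roleAdj r x y) ≡ true
    introduced x y x→y with view x
    ... | at-u refl e rewrite e with ==-either v c y x→y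
    ...   | inj₁ refl = ∨-introˡ _ (isEdge-forward u v)
    ...   | inj₂ refl =
      ∨-introʳ (isEdge u v u c) (∨-introˡ _ (subst (λ ρ → names ρ c ≡ true) (sym ru) (==-refl c)))
    introduced x y x→y | at-v refl e rewrite e with ==-either c u y x→y
    ...   | inj₁ refl =
      ∨-introʳ (isEdge u v v c) (∨-introˡ _ (subst (λ ρ → names ρ c ≡ true) (sym rv) (==-refl c)))
    ...   | inj₂ refl = ∨-introˡ _ (isEdge-backward u v)
    introduced x y x→y | at-c refl e rewrite e =
      ∨-introʳ (isEdge u v c y) (∨-introˡ _ (subst (λ ρ → names ρ y ≡ true) (sym rc) x→y))
    introduced x y x→y | elsewhere _ _ _ e rewrite e = ∨-introʳ (isEdge u v x y) (∨-introˡ _ x→y)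

    extended : Extension G (u , v)
    extended = extension r' well-formed' (represents-extend {G = G} {r = r} {r' = r'} u v rep kept introduced joined)
      where
      joined : roleAdj r' u v ≡ true
      joined rewrite r'u = ∨-introˡ _ (∨-introˡ _ (==-refl v))

    census-changed : Changed (census 0 0 1 0) ∅ (censusOf r) (censusOf r')
    census-changed =
      subst (λ o → Changed o ∅ (censusOf r) (censusOf r')) removed
            (changed-trans (changed-trans (census-update r u _) (census-update r₁ v _)) (census-update r₂ c _))
      where
      removed : (contribution u (r u) ⊕ contribution v (r₁ v)) ⊕ contribution c (r₂ c) ≡ census 0 0 1 0
      removed rewrite ru | ≔-minimal r (triangle v c) (u≢v ∘ sym) | rv
                    | ≔-minimal r₁ (triangle c u) (v≢c ∘ sym) | ≔-minimal r (triangle v c) (u≢c ∘ sym)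
                    | rc = refl

-- Legal moves

module _ {n : ℕ} where

  legal-sound : ∀ {G : Graph n} {u v} → legal G (u , v) ≡ true →
                toℕ u < toℕ v × adj G u v ≡ false × hasP4 ((u , v) ∷ G) ≡ false
  legal-sound {G} {u} {v} e with toℕ u <ᵇ toℕ v in lt | adj G u v | hasP4 ((u , v) ∷ G) | e
  ... | true  | false | false | _ = <ᵇ⇒< _ _ (≡⇒T lt) , refl , refl
  ... | false | _     | _     | ()
  ... | true  | true  | _     | ()
  ... | true  | false | true  | ()

  legal-complete : ∀ {G : Graph n} {u v} → toℕ u < toℕ v → adj G u v ≡ false →
                   hasP4 ((u , v) ∷ G) ≡ false → legal G (u , v) ≡ true
  legal-complete u<v ¬uv p4 rewrite <ᵇ-true u<v | ¬uv | p4 = refl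

  module Classify {G : Graph n} {r : Roles n} (wf : WellFormed r) (rep : Represents G r) where
    open WellFormed wf
    open WellFormedRoles wf

    Successor : Fin n × Fin n → Set
    Successor e = Σ (Extension G e) λ x → censusOf r ⟶ censusOf (roles x)

    successor-flip : ∀ {u v} → Successor (u , v) → Successor (v , u)
    successor-flip {u} {v} (extension r' wf' rep' , step) =
      extension r' wf' (represents-flip {G = G} {r = r'} u v rep') , step

    by-join : ∀ {u v} → r u ≡ isolated → r v ≡ isolated → u ≢ v → Successor (u , v)
    by-join ru rv u≢v =
      Join.extended {G = G} wf rep ru rv u≢v , join-step (Join.census-changed {G = G} wf rep ru rv u≢v)

    by-extend : ∀ {u v p} → r u ≡ isolated → r v ≡ paired p → Successor (u , v)
    by-extend ru rv =
      Extend.extended {G = G} wf rep ru rv , extend-step (Extend.census-changed {G = G} wf rep ru rv)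

    by-grow : ∀ {u v a b} → r u ≡ isolated → r v ≡ cherry a b → Successor (u , v)
    by-grow ru rv =
      Grow.extended {G = G} wf rep ru rv , grow-step (Grow.census-changed {G = G} wf rep ru rv)

    by-attach : ∀ {u v a b c} → r u ≡ isolated → r v ≡ star a b c → Successor (u , v)
    by-attach ru rv =
      Attach.extended {G = G} wf rep ru rv , attach-step (Attach.census-changed {G = G} wf rep ru rv) (star-counted rv)

    by-close : ∀ {u v c} → r c ≡ cherry u v → Successor (u , v)
    by-close rc =
      Close.extended {G = G} wf rep rc , close-step (Close.census-changed {G = G} wf rep rc)

    module _ {x y : Fin n} (free : P4Free ((x , y) ∷ G)) where

      old : ∀ {a b} → roleAdj r a b ≡ true → adj ((x , y) ∷ G) a b ≡ true
      old {a} {b} e = ∨-introʳ (isEdge x y a b) (trans (rep a b) e)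

      new : adj ((x , y) ∷ G) x y ≡ true
      new = ∨-introˡ _ (isEdge-forward x y)

      -- A new edge s-t between non-adjacent vertices extends to the path a-s-t-d.
      no-path-through : ∀ {s t} → adj ((x , y) ∷ G) s t ≡ true → roleAdj r s t ≡ false → s ≢ t →
                        ∀ {a d} → roleAdj r s a ≡ true → roleAdj r t d ≡ true → a ≢ d → ⊥
      no-path-through {s} {t} st ¬st s≢t {a} {d} sa td a≢d =
        free a s t d (a≢s , a≢t , a≢d , s≢t , s≢d , t≢d) (old (trans (roleAdj-sym r a s) sa)) st (old td)
        where
        a≢s : a ≢ s
        a≢s refl with () ← trans (sym sa) (roleAdj-irreflexive a)
        a≢t : a ≢ t
        a≢t refl with () ← trans (sym sa) ¬st
        s≢d : s ≢ d
        s≢d refl with () ← trans (sym (trans (roleAdj-sym r s t) td)) ¬st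
        t≢d : t ≢ d
        t≢d refl with () ← trans (sym td) (roleAdj-irreflexive t)

      no-second-neighbour : ∀ {s t} → adj ((x , y) ∷ G) s t ≡ true → roleAdj r s t ≡ false → s ≢ t →
                            ∀ a₁ a₂ → a₁ ≢ a₂ → roleAdj r s a₁ ≡ true → roleAdj r s a₂ ≡ true →
                            r t ≢ isolated → ⊥
      no-second-neighbour st ¬st s≢t a₁ a₂ a₁≢a₂ sa₁ sa₂ t≢ with some-neighbour _ t≢
      ... | d , td with a₁ ≟ d
      ...   | yes refl = no-path-through st ¬st s≢t sa₂ td (a₁≢a₂ ∘ sym)
      ...   | no a₁≢d  = no-path-through st ¬st s≢t sa₁ td a₁≢d

      from-isolated : r x ≡ isolated → x ≢ y → Successor (x , y)
      from-isolated rx x≢y with r y in ry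
      ... | isolated   = by-join rx ry x≢y
      ... | paired p   = by-extend rx ry
      ... | cherry a b = by-grow rx ry
      ... | star a b c = by-attach rx ry
      ... | leaf c with other-leaf ry
      ...   | z , rz , y≢z = ⊥-elim (free x y c z
              ( x≢y , centre≢ centre rx (λ ()) ∘ sym , ≢-by-role rx rz (λ ())
              , centre≢ centre ry (λ ()) ∘ sym , y≢z , centre≢ centre rz (λ ()))
              new (old (names⇒roleAdj ry (==-refl c))) (old (named⇒roleAdj rz (==-refl c))))
        where
        centre : IsCentre (r c)
        centre = leaf-centre ry
      from-isolated rx x≢y | triangle p q with triangle-next ry
      ... | (y≢p , p≢q , q≢y , rp) = ⊥-elim (free x y p q
              (x≢y , ≢-by-role rx rp (λ ()) , ≢-by-role rx rq (λ ()) , y≢p , q≢y ∘ sym , p≢q)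
              new (old (names⇒roleAdj ry (∨-introˡ _ (==-refl p))))
                  (old (names⇒roleAdj rp (∨-introˡ _ (==-refl q)))))
        where
        rq : r q ≡ triangle y p
        rq = proj₂ (proj₂ (proj₂ (triangle-next rp)))

      star-leaves-apart : ∀ {c a b d} → r x ≡ leaf c → r y ≡ leaf c → x ≢ y → r c ≡ star a b d → ⊥
      star-leaves-apart {c} {a} {b} {d} rx ry x≢y rc =
        let (a≢b , a≢d , b≢d , ra , rb , rd) = star-leaves rc in third-leaf a≢b a≢d b≢d ra rb rd
        where
        beyond : ∀ {t} → r t ≡ leaf c → t ≢ x → t ≢ y → ⊥
        beyond {t} rt t≢x t≢y = free x y c t
          ( x≢y , ≢-by-role rx rc (λ ()) , t≢x ∘ sym
          , ≢-by-role ry rc (λ ()) , t≢y ∘ sym , ≢-by-role rc rt (λ ()))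
          new (old (sole-neighbour (inj₂ ry))) (old (named⇒roleAdj rt (==-refl c)))
        third-leaf : a ≢ b → a ≢ d → b ≢ d → r a ≡ leaf c → r b ≡ leaf c → r d ≡ leaf c → ⊥
        third-leaf a≢b a≢d b≢d ra rb rd with a ≟ x | a ≟ y
        ... | no a≢x   | no a≢y   = beyond ra a≢x a≢y
        ... | yes refl | yes refl = x≢y refl
        ... | yes refl | no a≢y with b ≟ y
        ...   | no b≢y   = beyond rb (a≢b ∘ sym) b≢y
        ...   | yes refl = beyond rd (a≢d ∘ sym) (b≢d ∘ sym)
        third-leaf a≢b a≢d b≢d ra rb rd | no a≢x | yes refl with b ≟ x
        ...   | no b≢x   = beyond rb b≢x (a≢b ∘ sym)
        ...   | yes refl = beyond rd (b≢d ∘ sym) (a≢d ∘ sym)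

      -- Ends of degree one: their neighbours must coincide, and only a cherry centre can be
      -- that neighbour.
      between-ends : ∀ {zx zy} → r x ≡ paired zx ⊎ r x ≡ leaf zx → r y ≡ paired zy ⊎ r y ≡ leaf zy →
                     x ≢ y → roleAdj r x y ≡ false → Successor (x , y)
      between-ends {zx} {zy} hx hy x≢y ¬xy with zx ≟ zy
      ... | no zx≢zy = ⊥-elim (no-path-through new ¬xy x≢y (sole-neighbour hx) (sole-neighbour hy) zx≢zy)
      ... | yes refl with hx | hy
      ...   | inj₁ rx | _       = contradiction (partner-only rx (sole-neighbour hy)) (x≢y ∘ sym)
      ...   | inj₂ _  | inj₁ ry = contradiction (partner-only ry (sole-neighbour hx)) x≢y
      ...   | inj₂ rx | inj₂ ry with centre-role wf rx
      ...     | inj₂ (_ , _ , _ , rc) = ⊥-elim (star-leaves-apart rx ry x≢y rc)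
      ...     | inj₁ (_ , _ , rc) with proj₂ (proj₂ (proj₂ (cherry-leaves rc))) x rx
                                     | proj₂ (proj₂ (proj₂ (cherry-leaves rc))) y ry
      ...       | inj₁ refl | inj₁ refl = contradiction refl x≢y
      ...       | inj₁ refl | inj₂ refl = by-close rc
      ...       | inj₂ refl | inj₁ refl = successor-flip (by-close rc)
      ...       | inj₂ refl | inj₂ refl = contradiction refl x≢y

      new⁻¹ : adj ((x , y) ∷ G) y x ≡ true
      new⁻¹ = ∨-introˡ _ (isEdge-backward x y)

      between-components : r x ≢ isolated → r y ≢ isolated → x ≢ y → roleAdj r x y ≡ false → Successor (x , y)
      between-components x≢ y≢ x≢y ¬xy with neighbour-shape x x≢ | neighbour-shape y y≢
      ... | two-neighbours a₁ a₂ a₁≢a₂ xa₁ xa₂ | _ =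
        ⊥-elim (no-second-neighbour new ¬xy x≢y a₁ a₂ a₁≢a₂ xa₁ xa₂ y≢)
      ... | _ | two-neighbours a₁ a₂ a₁≢a₂ ya₁ ya₂ =
        ⊥-elim (no-second-neighbour new⁻¹ (trans (roleAdj-sym r y x) ¬xy) (x≢y ∘ sym)
                                     a₁ a₂ a₁≢a₂ ya₁ ya₂ x≢)
      ... | paired-end _ rx | paired-end _ ry = between-ends (inj₁ rx) (inj₁ ry) x≢y ¬xy
      ... | paired-end _ rx | leaf-end _ ry   = between-ends (inj₁ rx) (inj₂ ry) x≢y ¬xy
      ... | leaf-end _ rx   | paired-end _ ry = between-ends (inj₂ rx) (inj₁ ry) x≢y ¬xy
      ... | leaf-end _ rx   | leaf-end _ ry   = between-ends (inj₂ rx) (inj₂ ry) x≢y ¬xy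

    P4Free-flip : ∀ {x y} → P4Free ((x , y) ∷ G) → P4Free ((y , x) ∷ G)
    P4Free-flip {x} {y} free a b c d D ab bc cd = free a b c d D (flip ab) (flip bc) (flip cd)
      where
      flip : ∀ {s t} → adj ((y , x) ∷ G) s t ≡ true → adj ((x , y) ∷ G) s t ≡ true
      flip {s} {t} = subst (λ e → (e ∨ adj G s t) ≡ true) (isEdge-flip x y s t)

    classify : ∀ u v → legal G (u , v) ≡ true → Successor (u , v)
    classify u v lg = by-roles (isolated? (r u)) (isolated? (r v))
      where
      parts : toℕ u < toℕ v × adj G u v ≡ false × hasP4 ((u , v) ∷ G) ≡ false
      parts = legal-sound {G = G} lg
      u≢v : u ≢ v
      u≢v refl = <-irrefl refl (proj₁ parts)
      ¬uv : roleAdj r u v ≡ false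
      ¬uv = trans (sym (rep u v)) (proj₁ (proj₂ parts))
      free : P4Free ((u , v) ∷ G)
      free = ¬hasP4⇒P4Free ((u , v) ∷ G) (proj₂ (proj₂ parts))
      by-roles : Dec (r u ≡ isolated) → Dec (r v ≡ isolated) → Successor (u , v)
      by-roles (yes ru) _        = from-isolated {u} {v} free ru u≢v
      by-roles (no u≢) (yes rv) = successor-flip (from-isolated {v} {u} (P4Free-flip {u} {v} free) rv (u≢v ∘ sym))
      by-roles (no u≢) (no v≢)  = between-components {u} {v} free u≢ v≢ u≢v ¬uv

  edge∈edgesK : ∀ (x y : Fin n) → (x , y) ∈ edgesK n
  edge∈edgesK x y = ∈-concatMap⁺ (λ i → map (λ j → (i , j)) (verts n))
    (lose (∈-allFin x) (∈-map⁺ (λ j → (x , j)) (∈-allFin y)))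

  moves-sound : ∀ {G : Graph n} {e} → e ∈ moves G → legal G e ≡ true
  moves-sound {G} e∈ = proj₂ (∈-filter⁻ (λ e → legal G e Bool.≟ true) {xs = edgesK n} e∈)

  moves-complete : ∀ {G : Graph n} {x y} → legal G (x , y) ≡ true → (x , y) ∈ moves G
  moves-complete {G} {x} {y} = ∈-filter⁺ (λ e → legal G e Bool.≟ true) (edge∈edgesK x y)

  module Realise {G : Graph n} {r : Roles n} (wf : WellFormed r) (rep : Represents G r) where
    open WellFormed wf
    open WellFormedRoles wf using (roleAdj⇒neighbour)

    Realisation : Census → Set
    Realisation c' = ∃[ e ] e ∈ moves G × Σ (Extension G e) λ X → censusOf (roles X) ≡ c'

    legal-edge : ∀ {x y r'} → toℕ x < toℕ y → roleAdj r x y ≡ false →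
                 WellFormed r' → Represents ((x , y) ∷ G) r' → (x , y) ∈ moves G
    legal-edge {x} {y} x<y ¬xy wf' rep' =
      moves-complete {G = G} (legal-complete {G = G} x<y (trans (rep x y) ¬xy)
                                             (P4Free⇒¬hasP4 ((x , y) ∷ G) (represented-P4Free {G = (x , y) ∷ G} wf' rep')))

    -- The new edge x-y is a legal move in whichever orientation lists the smaller vertex first.
    realised : ∀ {x y o a c'} → x ≢ y → roleAdj r x y ≡ false → (X : Extension G (x , y)) →
               Changed o a (censusOf r) (censusOf (roles X)) → Changed o a (censusOf r) c' → Realisation c'
    realised {x} {y} x≢y ¬xy X@(extension r' wf' rep') ch ch'
      with <-cmp (toℕ x) (toℕ y)
    ... | tri< x<y _ _ = (x , y) , legal-edge x<y ¬xy wf' rep' , X , changed-unique ch ch'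
    ... | tri≈ _ x=y _ = contradiction (toℕ-injective x=y) x≢y
    ... | tri> _ _ y<x =
      (y , x) , legal-edge y<x (trans (roleAdj-sym r y x) ¬xy) wf' rep⁻¹ , extension r' wf' rep⁻¹ , changed-unique ch ch'
      where
      rep⁻¹ : Represents ((y , x) ∷ G) r'
      rep⁻¹ = represents-flip {G = G} {r = r'} x y rep'

    isolated-alone : ∀ {x} y → r x ≡ isolated → roleAdj r x y ≡ false
    isolated-alone {x} y rx = ¬-not λ e → subst (λ ρ → NeighbourOf ρ r x y) rx (roleAdj⇒neighbour x y e)

    realise : ∀ {c c'} → c ⟶ c' → censusOf r ≡ c → Realisation c'
    realise {c} {c'} mv eq = by-move mv (subst (λ c → Changed (lost mv) (gained mv) c c') (sym eq) (⟶-changed mv))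
      where
      at-least : ∀ (π : Census → ℕ) {k} → k ≤ π c → k ≤ π (censusOf r)
      at-least π = subst (_ ≤_) (sym (cong π eq))
      by-move : (mv : c ⟶ c') → Changed (lost mv) (gained mv) (censusOf r) c' → Realisation c'
      by-move join ch with two-isolated-witness r (at-least #isolated (s≤s (s≤s z≤n)))
      ... | x , y , x≢y , rx , ry =
        realised x≢y (isolated-alone y rx)
                 (Join.extended {G = G} wf rep rx ry x≢y) (Join.census-changed {G = G} wf rep rx ry x≢y) ch
      by-move extend ch
        with isolated-witness r (at-least #isolated (s≤s z≤n)) | paired-witness r (at-least #pairs (s≤s z≤n))
      ... | x , rx | v , p , rv =
        realised (≢-by-role rx rv λ ()) (isolated-alone v rx)
                 (Extend.extended {G = G} wf rep rx rv) (Extend.census-changed {G = G} wf rep rx rv) ch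
      by-move grow ch
        with isolated-witness r (at-least #isolated (s≤s z≤n)) | cherry-witness r (at-least #cherries (s≤s z≤n))
      ... | x , rx | v , a , b , rv =
        realised (≢-by-role rx rv λ ()) (isolated-alone v rx)
                 (Grow.extended {G = G} wf rep rx rv) (Grow.census-changed {G = G} wf rep rx rv) ch
      by-move attach ch
        with isolated-witness r (at-least #isolated (s≤s z≤n)) | star-witness r (at-least #stars (s≤s z≤n))
      ... | x , rx | v , a , b , d , rv =
        realised (≢-by-role rx rv λ ()) (isolated-alone v rx)
                 (Attach.extended {G = G} wf rep rx rv) (Attach.census-changed {G = G} wf rep rx rv) ch
      by-move close ch with cherry-witness r (at-least #cherries (s≤s z≤n))
      ... | v , a , b , rv with cherry-leaves rv
      ...   | a≢b , ra , rb , _ =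
        realised a≢b leaves-apart (Close.extended {G = G} wf rep rv) (Close.census-changed {G = G} wf rep rv) ch
        where
        leaves-apart : roleAdj r a b ≡ false
        leaves-apart = ¬-not λ e →
          ≢-by-role rb rv (λ ()) (subst (λ ρ → NeighbourOf ρ r a b) ra (roleAdj⇒neighbour a b e))

-- Game values

maxL-≥ : ∀ x xs {y} → y ∈ x ∷ xs → y ≤ maxL x xs
maxL-≥ x []       (here refl)         = ≤-refl
maxL-≥ x (z ∷ zs) (here refl)         = ≤-trans (maxL-≥ x zs (here refl)) (m≤n⊔m z _)
maxL-≥ x (z ∷ zs) (there (here refl)) = m≤m⊔n z _
maxL-≥ x (z ∷ zs) (there (there y∈)) = ≤-trans (maxL-≥ x zs (there y∈)) (m≤n⊔m z _)

minL-≤ : ∀ x xs {y} → y ∈ x ∷ xs → minL x xs ≤ y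
minL-≤ x []       (here refl)         = ≤-refl
minL-≤ x (z ∷ zs) (here refl)         = ≤-trans (m⊓n≤n z _) (minL-≤ x zs (here refl))
minL-≤ x (z ∷ zs) (there (here refl)) = m⊓n≤m z _
minL-≤ x (z ∷ zs) (there (there y∈)) = ≤-trans (m⊓n≤n z _) (minL-≤ x zs (there y∈))

opt-selective : ∀ p x xs → opt p x xs ∈ x ∷ xs
opt-selective Prolonger x xs = [ here , there ]′ (foldr-selective ⊔-sel x xs)
opt-selective Shortener x xs = [ here , there ]′ (foldr-selective ⊓-sel x xs)

∈⇒∷ : ∀ {A : Set} {x : A} {xs} → x ∈ xs → ∃[ y ] ∃[ ys ] xs ≡ y ∷ ys
∈⇒∷ {xs = y ∷ ys} _ = y , ys , refl

module _ {n : ℕ} where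

  play-stuck : ∀ f p {G : Graph n} → moves G ≡ [] → play f p G ≡ 0
  play-stuck zero    p     eq = refl
  play-stuck (suc f) p {G} eq rewrite eq = refl

  successorValues : ℕ → Player → Graph n → List (Fin n × Fin n) → List ℕ
  successorValues f p G = map λ e → play f (other p) (e ∷ G)

  play-unfold : ∀ f p {G : Graph n} {e es} → moves G ≡ e ∷ es →
                play (suc f) p G ≡ suc (opt p (play f (other p) (e ∷ G)) (successorValues f p G es))
  play-unfold f p {G} eq rewrite eq = refl

  play-attained : ∀ f p {G : Graph n} {e} → e ∈ moves G →
                  ∃[ e' ] e' ∈ moves G × play (suc f) p G ≡ suc (play f (other p) (e' ∷ G))
  play-attained f p {G} e∈ =
    let (e₀ , es , eq) = ∈⇒∷ e∈
        (e' , e'∈ , value) = ∈-map⁻ (λ e → play f (other p) (e ∷ G)) (opt-selective p _ (successorValues f p G es))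
    in  e' , subst (e' ∈_) (sym eq) e'∈ , trans (play-unfold f p eq) (cong suc value)

  play-Prolonger-≥ : ∀ f {G : Graph n} {e} → e ∈ moves G →
                     suc (play f Shortener (e ∷ G)) ≤ play (suc f) Prolonger G
  play-Prolonger-≥ f {G} {e} e∈ =
    let (_ , _ , eq) = ∈⇒∷ e∈
    in  subst (suc (play f Shortener (e ∷ G)) ≤_) (sym (play-unfold f Prolonger eq))
              (s≤s (maxL-≥ _ _ (∈-map⁺ (λ e → play f Shortener (e ∷ G)) (subst (e ∈_) eq e∈))))

  play-Shortener-≤ : ∀ f {G : Graph n} {e} → e ∈ moves G →
                     play (suc f) Shortener G ≤ suc (play f Prolonger (e ∷ G))
  play-Shortener-≤ f {G} {e} e∈ =
    let (_ , _ , eq) = ∈⇒∷ e∈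
    in  subst (_≤ suc (play f Prolonger (e ∷ G))) (sym (play-unfold f Shortener eq))
              (s≤s (minL-≤ _ _ (∈-map⁺ (λ e → play f Prolonger (e ∷ G)) (subst (e ∈_) eq e∈))))

combine-lower : ∀ {L L' v V} → L ≤ 5 + L' → L' ≤ 5 * v + 6 → suc v ≤ V → L ≤ 5 * V + 6
combine-lower {L} {L'} {v} {V} step ih played = begin
  L                  ≤⟨ step ⟩
  5 + L'             ≤⟨ +-monoʳ-≤ 5 ih ⟩
  5 + (5 * v + 6)    ≡⟨ +-assoc 5 (5 * v) 6 ⟨
  5 + 5 * v + 6      ≡⟨ cong (_+ 6) (*-suc 5 v) ⟨
  5 * suc v + 6      ≤⟨ +-monoˡ-≤ 6 (*-monoʳ-≤ 5 played) ⟩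
  5 * V + 6          ∎
  where open ≤-Reasoning

combine-upper : ∀ {U U' v V} → 5 + U' ≤ U → 5 * v + 6 ≤ U' → V ≤ suc v → 5 * V + 6 ≤ U
combine-upper {U} {U'} {v} {V} step ih played = begin
  5 * V + 6          ≤⟨ +-monoˡ-≤ 6 (*-monoʳ-≤ 5 played) ⟩
  5 * suc v + 6      ≡⟨ cong (_+ 6) (*-suc 5 v) ⟩
  5 + 5 * v + 6      ≡⟨ +-assoc 5 (5 * v) 6 ⟩
  5 + (5 * v + 6)    ≤⟨ +-monoʳ-≤ 5 ih ⟩
  5 + U'             ≤⟨ step ⟩
  U                  ∎
  where open ≤-Reasoning

fuel-step : ∀ {c c' f} → c ⟶ c' → measure c ≤ suc f → measure c' ≤ f
fuel-step mv fuel = ≤-pred (≤-trans (measure-decreases mv) fuel)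

module _ {n : ℕ} {G : Graph n} {r : Roles n} (wf : WellFormed r) (rep : Represents G r) where

  playable : ∀ {e} → e ∈ moves G → Playable (censusOf r)
  playable {e} e∈ =
    let (X , mv) = Classify.classify {G = G} wf rep (proj₁ e) (proj₂ e) (moves-sound {G = G} e∈) in _ , mv

  stuck : moves G ≡ [] → Stuck (censusOf r)
  stuck no-moves = ¬Playable⇒Stuck (censusOf r) λ (_ , mv) →
    let (e , e∈ , _) = Realise.realise {G = G} wf rep mv refl in ¬Any[] (subst (e ∈_) no-moves e∈)

moves-cases : ∀ {n} (G : Graph n) → moves G ≡ [] ⊎ ∃[ e ] e ∈ moves G
moves-cases G with moves G
... | []    = inj₁ refl
... | e ∷ _ = inj₂ (e , here refl)

lower : ∀ {n} f p {G : Graph n} {r} → WellFormed r → Represents G r → measure (censusOf r) ≤ f →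
        lowerPotential p (censusOf r) ≤ 5 * play f p G + 6
lower zero p {r = r} wf rep fuel = lower-stuck p (measure≤0⇒Stuck (censusOf r) fuel)
lower (suc f) p {G} {r} wf rep fuel with moves-cases G
... | inj₁ no-moves =
  subst (λ v → lowerPotential p (censusOf r) ≤ 5 * v + 6) (sym (play-stuck (suc f) p no-moves))
        (lower-stuck p (stuck {G = G} wf rep no-moves))
lower (suc f) Shortener {G} {r} wf rep fuel | inj₂ (e , e∈) =
  let (e' , e'∈ , value) = play-attained f Shortener e∈
      (X , mv) = Classify.classify {G = G} wf rep (proj₁ e') (proj₂ e') (moves-sound {G = G} e'∈)
  in  combine-lower (lower-Shortener-move mv)
                    (lower f Prolonger {G = e' ∷ G} (well-formed X) (represents X) (fuel-step mv fuel))
                    (≤-reflexive (sym value))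
lower (suc f) Prolonger {G} {r} wf rep fuel | inj₂ (e , e∈) =
  let (c' , mv , gain) = lower-Prolonger-strategy (censusOf r) (playable {G = G} wf rep e∈)
      (e' , e'∈ , X , census≡) = Realise.realise {G = G} wf rep mv refl
      ih = lower f Shortener {G = e' ∷ G} (well-formed X) (represents X)
                 (subst (λ c → measure c ≤ f) (sym census≡) (fuel-step mv fuel))
  in  combine-lower gain (subst (λ c → lowerPotential Shortener c ≤ 5 * play f Shortener (e' ∷ G) + 6) census≡ ih)
                    (play-Prolonger-≥ f e'∈)

upper : ∀ {n} f p {G : Graph n} {r} → WellFormed r → Represents G r → measure (censusOf r) ≤ f →
        5 * play f p G + 6 ≤ upperPotential p (censusOf r)
upper zero p {r = r} wf rep fuel = upper-stuck p (measure≤0⇒Stuck (censusOf r) fuel)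
upper (suc f) p {G} {r} wf rep fuel with moves-cases G
... | inj₁ no-moves =
  subst (λ v → 5 * v + 6 ≤ upperPotential p (censusOf r)) (sym (play-stuck (suc f) p no-moves))
        (upper-stuck p (stuck {G = G} wf rep no-moves))
upper (suc f) Prolonger {G} {r} wf rep fuel | inj₂ (e , e∈) =
  let (e' , e'∈ , value) = play-attained f Prolonger e∈
      (X , mv) = Classify.classify {G = G} wf rep (proj₁ e') (proj₂ e') (moves-sound {G = G} e'∈)
  in  combine-upper (upper-Prolonger-move mv)
                    (upper f Shortener {G = e' ∷ G} (well-formed X) (represents X) (fuel-step mv fuel))
                    (≤-reflexive value)
upper (suc f) Shortener {G} {r} wf rep fuel | inj₂ (e , e∈) =
  let (c' , mv , gain) = upper-Shortener-strategy (censusOf r) (playable {G = G} wf rep e∈)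
      (e' , e'∈ , X , census≡) = Realise.realise {G = G} wf rep mv refl
      ih = upper f Prolonger {G = e' ∷ G} (well-formed X) (represents X)
                 (subst (λ c → measure c ≤ f) (sym census≡) (fuel-step mv fuel))
  in  combine-upper gain (subst (λ c → 5 * play f Prolonger (e' ∷ G) + 6 ≤ upperPotential Prolonger c) census≡ ih)
                    (play-Shortener-≤ f e'∈)

module Start (n : ℕ) where

  roles₀ : Roles n
  roles₀ _ = isolated

  well-formed₀ : WellFormed roles₀
  well-formed₀ = record
    { paired-partner = λ () ; cherry-leaves = λ () ; star-leaves = λ () ; leaf-centre = λ () ; triangle-next = λ () }

  represents₀ : Represents [] roles₀
  represents₀ _ _ = refl

  census₀ : censusOf roles₀ ≡ census n 0 0 0
  census₀ = all-isolated n
    where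
    all-isolated : ∀ m → total {m} (λ _ → census 1 0 0 0) ≡ census m 0 0 0
    all-isolated zero    = refl
    all-isolated (suc m) = cong (census 1 0 0 0 ⊕_) (all-isolated m)

lowerPotential-start : ∀ p n → 4 * n ≤ lowerPotential p (census n 0 0 0)
lowerPotential-start p n =
  subst (_≤ lowerPotential p (census n 0 0 0)) (lemma n) (m≤n+m _ (lowerTable p true true true))
  where lemma : ∀ n → 2 * (2 * n + 0) ≡ 4 * n
        lemma = solve-∀

upperPotential-start : ∀ p n → upperPotential p (census n 0 0 0) ≤ (4 * n + 4) + 6
upperPotential-start p n = subst (upperPotential p (census n 0 0 0) ≤_) (lemma n) (+-monoˡ-≤ _ (table p (size n)))
  where
  lemma : ∀ n → 10 + (4 * n + 2 * 0 + 5 * 0) ≡ (4 * n + 4) + 6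
  lemma = solve-∀
  table : ∀ p w → upperTable p w true true true ≤ 10
  table Prolonger w = checked (everySize-sound (λ w → upperTable Prolonger w true true true ≤ᵇ 10) _ w)
  table Shortener w = checked (everySize-sound (λ w → upperTable Shortener w true true true ≤ᵇ 10) _ w)

gameSat-potentials : ∀ n p → 2 ≤ n →
  lowerPotential p (census n 0 0 0) ≤ 5 * gameSat n p + 6 × 5 * gameSat n p + 6 ≤ upperPotential p (census n 0 0 0)
gameSat-potentials n p 2≤n =
  subst (λ c → lowerPotential p c ≤ 5 * gameSat n p + 6) census₀
        (lower (n * n) p {G = []} well-formed₀ represents₀ fuel) ,
  subst (λ c → 5 * gameSat n p + 6 ≤ upperPotential p c) census₀
        (upper (n * n) p {G = []} well-formed₀ represents₀ fuel)
  where
  open Start n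
  fuel : measure (censusOf roles₀) ≤ n * n
  fuel = subst (λ c → measure c ≤ n * n) (sym census₀)
               (subst (_≤ n * n) (sym (+-identityʳ (2 * n))) (*-monoˡ-≤ n {2} {n} 2≤n))

theorem2 : (n : ℕ) → 0 < n → (p : Player) →
    (4 * n ≤ 5 * gameSat n p + 8) × (5 * gameSat n p ≤ 4 * n + 5)
-- With a single vertex there is no move, and the fuel 1 * 1 is too small for the general argument.
theorem2 (suc zero) _ p = checked _ , checked _
theorem2 n@(suc (suc _)) _ p =
  let (lower-bound , upper-bound) = gameSat-potentials n p (s≤s (s≤s z≤n))
  in  ≤-trans (lowerPotential-start p n) (≤-trans lower-bound (+-monoʳ-≤ (5 * gameSat n p) (checked _))) ,
      ≤-trans (+-cancelʳ-≤ 6 _ _ (≤-trans upper-bound (upperPotential-start p n))) (+-monoʳ-≤ (4 * n) (n≤1+n 4))
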